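{- Let $(c_n)_{n\ge0}$ be a sequence of nonzero numbers with $c_0=1$, let $\omega$ be an umbra with $\omega^n\simeq n!/c_n$ for all $n\ge0$, and let $\gamma,\alpha,\lambda$ be umbrae. For any integers $m,n,k$ with $n\ge k\ge 0$, \[ {}_{\omega}(\gamma,\alpha)_{n,k}\simeq\frac{c_n}{c_k}\sum_{i=0}^{n-k}\frac{\big(m.\mathfrak K_{\alpha,\lambda}\big)^{i}}{i!}\,\frac{\big(\gamma+(k-m).\alpha+i.\lambda\big)^{n-k-i}}{(n-k-i)!}. \] Equivalently, \[ {}_{\omega}(\gamma,\alpha)_{n,k}\simeq\frac{c_n}{c_k\,c_{n-k}}\sum_{i=0}^{n-k}c_i\,\frac{\big(m.\mathfrak K_{\alpha,\lambda}\big)^{i}}{i!}\;{}_{\omega}\big(\gamma+(k-m).\alpha,\lambda\big)_{n-k,i}. \]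
   Context: Classical umbral calculus: $R=\mathbb{C}[x]$, $A$ a saturated alphabet of umbrae, $E:R[A]\to R$ linear with $E[1]=1$ and $E[\alpha^i\beta^j\cdots]=E[\alpha^i]E[\beta^j]\cdots$ for distinct umbrae; $p\simeq q$ means $E[p]=E[q]$, $p\equiv q$ means $p^n\simeq q^n$ for all $n$. $f_\alpha(t)=\sum_n E[\alpha^n]t^n/n!$. For $x\in R\cup A$ (e.g. any integer) $x.\alpha$ is the umbra (up to similarity) with $(x.\alpha)^n\simeq n![t^n]f_\alpha(t)^x$. For umbrae $\sigma,\alpha$, $\mathfrak K_{\sigma,\alpha}$ is an umbra with $\mathfrak K_{\sigma,\alpha}^0=1$ and $\mathfrak K_{\sigma,\alpha}^n\simeq\sigma(\sigma+(-n).\alpha)^{n-1}$ for $n\ge1$ (here $(-n).\alpha$ is uncorrelated with $\sigma$); $m.\mathfrak K_{\alpha,\lambda}$ is the dot product just defined. For umbral polynomials $p,q$ (e.g. $p=\gamma+(k-m).\alpha$), the $\omega$-Riordan array ${}_\omega(p,q)$ is the infinite lower triangular matrix with entries ${}_\omega(p,q)_{n,k}=E\!\left[\frac{c_n}{c_k}\frac{(p+k.q)^{n-k}}{(n-k)!}\right]\in R$ for $n\ge k\ge0$. Convention: distinct auxiliary umbrae in a formula (such as $m.\mathfrak K_{\alpha,\lambda}$, $\gamma$, $(k-m).\alpha$, $i.\lambda$) are represented by mutually uncorrelated umbrae. -}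

module Defs where

open import Algebra.Bundles using (CommutativeRing)
open import Data.Nat.Base using (ℕ; zero; suc; _∸_) renaming (_+_ to _ℕ+_)
open import Data.Nat.Combinatorics using (_C_)
open import Data.Integer.Base using (ℤ; +_; -[1+_])

-- An umbra (or an umbral polynomial in mutually uncorrelated umbrae) is
-- represented, up to similarity, by its moment sequence  n ↦ E[α^n]  in the
-- commutative ring R.  Sums of uncorrelated umbrae correspond to binomial
-- convolution of moment sequences (product of exponential generating functions).
module UC {a ℓ} (R : CommutativeRing a ℓ) where
  open CommutativeRing R

  ι : ℕ → Carrier
  ι zero = 0#
  ι (suc n) = 1# + ι n

  sgn : ℕ → Carrier
  sgn zero = 1#
  sgn (suc k) = - sgn k

  Σ≤ : ℕ → (ℕ → Carrier) → Carrier
  Σ≤ zero f = f 0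
  Σ≤ (suc n) f = Σ≤ n f + f (suc n)

  Π< : ℕ → (ℕ → Carrier) → Carrier
  Π< zero f = 1#
  Π< (suc n) f = Π< n f * f n

  Moments : Set a
  Moments = ℕ → Carrier

  ε : Moments
  ε zero = 1#
  ε (suc n) = 0#

  _⊕_ : Moments → Moments → Moments
  (p ⊕ q) n = Σ≤ n (λ j → ι (n C j) * (p j * q (n ∸ j)))

  infixl 6 _⊕_

  -- generalized binomial coefficient  binom(x, k)  for an integer x, in R
  -- binom(-(n+1), k) = (-1)^k binom(n+k, k)
  gbinom : ℤ → ℕ → Carrier
  gbinom (+ n) k = ι (n C k)
  gbinom -[1+ n ] k = sgn k * ι ((n ℕ+ k) C k)

  shift0 : Moments → Moments
  shift0 p zero = 0#
  shift0 p (suc n) = p (suc n)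

  powc : Moments → ℕ → Moments
  powc p zero = ε
  powc p (suc k) = shift0 p ⊕ powc p k

  -- dot product x.α for an integer x:  E[(x.α)^n] = n! [t^n] f_α(t)^x,
  -- with f^x = Σ_k binom(x,k) (f - 1)^k  (finite in each degree since f(0)=1)
  dot : ℤ → Moments → Moments
  dot x p n = Σ≤ n (λ k → gbinom x k * powc p k n)

  -- 𝔎_{σ,α}:  𝔎^0 = 1,  𝔎^n ≃ σ (σ + (-n).α)^{n-1}  for n ≥ 1
  𝔎 : Moments → Moments → Moments
  𝔎 σ α zero = 1#
  𝔎 σ α (suc p) =
    Σ≤ p (λ j → ι (p C j) * (σ (suc j) * dot -[1+ p ] α (p ∸ j)))

  -- 1/n!  given inverses invN j = 1/(j+1)
  invfact : (ℕ → Carrier) → ℕ → Carrier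
  invfact invN n = Π< n invN

  -- ω-Riordan array entry  E[ (c_n/c_k) (p + k.q)^{n-k} / (n-k)! ]
  -- for uncorrelated umbral polynomials p, q (given by their moments);
  -- cinv k = 1/c_k, invN j = 1/(j+1).
  ωRiordan : (ℕ → Carrier) → (c cinv : ℕ → Carrier) →
             Moments → Moments → ℕ → ℕ → Carrier
  ωRiordan invN c cinv p q n k =
    c n * cinv k * ((p ⊕ dot (+ k) q) (n ∸ k) * invfact invN (n ∸ k))

-- The heart of the proof is
-- umbral Lagrange inversion: if U i are the moments of (t f_λ(t))^i / i! and
-- comp K = Σ_i K i · U i (composition of f_K with t f_λ(t)), then
-- comp 𝔎_{α,λ} = α.  As comp is a ring homomorphism it commutes with dot
-- products, so m.α = comp (m.𝔎_{α,λ}); multiplying by γ + (k-m).α gives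
--   (γ + k.α)^N = Σ_i (N choose i) (m.𝔎_{α,λ})^i (γ + (k-m).α + i.λ)^(N-i),
-- the first identity once (N choose i)/N! is split into 1/i! · 1/(N-i)!; the
-- second identity merely rewrites the summands as ω-Riordan entries.
module Submission where

open import Defs
open import Algebra.Bundles using (CommutativeRing)
open import Data.Nat.Base using (ℕ; suc; _∸_; _≤_; _!)
open import Data.Integer.Base using (ℤ; +_) renaming (_-_ to _-ℤ_)
open import Data.Product using (_×_)

open import Data.Nat.Base using (zero; _<_; z≤n; s≤s)
  renaming (_+_ to _+ℕ_; _*_ to _*ℕ_)
import Data.Nat.Properties as ℕₚ
open import Data.Nat.Combinatorics using (_C_; nCn≡1; nCk+nC[k+1]≡[n+1]C[k+1])
open import Data.Integer.Base as ℤ using (-[1+_])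
import Data.Integer.Properties as ℤₚ
open import Data.Product using (_,_)
open import Data.Sum using (inj₁; inj₂)
open import Data.Empty using (⊥-elim)
open import Relation.Nullary using (yes; no)
open import Relation.Binary.Definitions using (tri<; tri≈; tri>)
open import Relation.Binary.PropositionalEquality as ≡ using (_≡_; _≢_)

module Binomial where
  open import Data.Nat.Base
  open import Data.Nat.Properties
  open import Data.Nat.Combinatorics
    using (_C_; nCk≡n!/k![n-k]!; k![n∸k]!∣n!; nCn≡1; nCk+nC[k+1]≡[n+1]C[k+1])
  open import Data.Nat.DivMod using (m/n*n≡m)
  open import Relation.Binary.PropositionalEquality
  open ≡-Reasoning
  open import Data.Nat.Tactic.RingSolver using (solve-∀)

  -- The binomial coefficient written symmetrically: B a b = (a+b choose a),
  -- so that (t^a/a!)(t^b/b!) = B a b · t^(a+b)/(a+b)!.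
  B : ℕ → ℕ → ℕ
  B a b = (a + b) C a

  C-factorials : ∀ {n k} → k ≤ n → (n C k) * (k ! * (n ∸ k) !) ≡ n !
  C-factorials {n} {k} k≤n = begin
    (n C k) * (k ! * (n ∸ k) !)                   ≡⟨ cong (_* (k ! * (n ∸ k) !)) (nCk≡n!/k![n-k]! k≤n) ⟩
    (n ! / (k ! * (n ∸ k) !)) * (k ! * (n ∸ k) !) ≡⟨ m/n*n≡m (k![n∸k]!∣n! k≤n) ⟩
    n !                                           ∎
    where
    instance
      factorials-nonzero : NonZero (k ! * (n ∸ k) !)
      factorials-nonzero = k !* (n ∸ k) !≢0

  C≡B : ∀ {n j} → j ≤ n → n C j ≡ B j (n ∸ j)
  C≡B {n} {j} j≤n = cong (_C j) (sym (m+[n∸m]≡n j≤n))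

  B-factorials : ∀ a b → B a b * (a ! * b !) ≡ (a + b) !
  B-factorials a b = subst (λ x → B a b * (a ! * x !) ≡ (a + b) !) (m+n∸m≡n a b)
                           (C-factorials (m≤m+n a b))

  -- B-sym, B-assoc and B-absorb follow from B-factorials by cancelling the
  -- (nonzero) factorials.
  B-sym : ∀ a b → B a b ≡ B b a
  B-sym a b = *-cancelʳ-≡ _ _ (a ! * b !) {{a !* b !≢0}} (begin
    B a b * (a ! * b !) ≡⟨ B-factorials a b ⟩
    (a + b) !           ≡⟨ cong _! (+-comm a b) ⟩
    (b + a) !           ≡⟨ B-factorials b a ⟨
    B b a * (b ! * a !) ≡⟨ cong (B b a *_) (*-comm (b !) (a !)) ⟩
    B b a * (a ! * b !) ∎)

  -- (a+b+c)!/(a! b! c!) computed in the two possible orders.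
  B-assoc : ∀ a b c → B (a + b) c * B a b ≡ B a (b + c) * B b c
  B-assoc a b c = *-cancelʳ-≡ _ _ (a ! * (b ! * c !)) {{m*n≢0 (a !) (b ! * c !) {{a !≢0}} {{b !* c !≢0}}}} (begin
    B (a + b) c * B a b * (a ! * (b ! * c !))   ≡⟨ regroupˡ (B (a + b) c) (B a b) (a !) (b !) (c !) ⟩
    B (a + b) c * ((B a b * (a ! * b !)) * c !) ≡⟨ cong (λ t → B (a + b) c * (t * c !)) (B-factorials a b) ⟩
    B (a + b) c * ((a + b) ! * c !)             ≡⟨ B-factorials (a + b) c ⟩
    (a + b + c) !                               ≡⟨ cong _! (+-assoc a b c) ⟩
    (a + (b + c)) !                             ≡⟨ B-factorials a (b + c) ⟨
    B a (b + c) * (a ! * (b + c) !)             ≡⟨ cong (λ t → B a (b + c) * (a ! * t)) (B-factorials b c) ⟨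
    B a (b + c) * (a ! * (B b c * (b ! * c !))) ≡⟨ regroupʳ (B a (b + c)) (B b c) (a !) (b !) (c !) ⟨
    B a (b + c) * B b c * (a ! * (b ! * c !))   ∎)
    where
    regroupˡ : ∀ x y p q r → x * y * (p * (q * r)) ≡ x * ((y * (p * q)) * r)
    regroupˡ = solve-∀
    regroupʳ : ∀ x y p q r → x * y * (p * (q * r)) ≡ x * (p * (y * (q * r)))
    regroupʳ = solve-∀

  B-absorb : ∀ a r → suc r * B a (suc r) ≡ suc a * B (suc a) r
  B-absorb a r = *-cancelʳ-≡ _ _ (a ! * r !) {{a !* r !≢0}} (begin
    suc r * B a (suc r) * (a ! * r !) ≡⟨ moveʳ (suc r) (B a (suc r)) (a !) (r !) ⟩
    B a (suc r) * (a ! * suc r !)     ≡⟨ B-factorials a (suc r) ⟩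
    (a + suc r) !                     ≡⟨ cong _! (+-suc a r) ⟩
    (suc a + r) !                     ≡⟨ B-factorials (suc a) r ⟨
    B (suc a) r * (suc a ! * r !)     ≡⟨ moveˡ a (B (suc a) r) (a !) (r !) ⟨
    suc a * B (suc a) r * (a ! * r !) ∎)
    where
    moveʳ : ∀ s x p q → s * x * (p * q) ≡ x * (p * (s * q))
    moveʳ = solve-∀
    moveˡ : ∀ s x p q → suc s * x * (p * q) ≡ x * ((suc s * p) * q)
    moveˡ = solve-∀

  B-pascal : ∀ a b → B (suc a) (suc b) ≡ B a (suc b) + B (suc a) b
  B-pascal a b = begin
    suc (a + suc b) C suc a               ≡⟨ nCk+nC[k+1]≡[n+1]C[k+1] (a + suc b) a ⟨
    (a + suc b) C a + (a + suc b) C suc a ≡⟨ cong (λ n → (a + suc b) C a + n C suc a) (+-suc a b) ⟩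
    B a (suc b) + B (suc a) b             ∎

  B-zeroʳ : ∀ a → B a 0 ≡ 1
  B-zeroʳ a = trans (cong (_C a) (+-identityʳ a)) (nCn≡1 a)

module Sums {a ℓ} (R : CommutativeRing a ℓ) where
  open CommutativeRing R hiding (zero)
  open UC R
  open import Relation.Binary.Reasoning.Setoid setoid
  open import Algebra.Properties.Ring ring using (-‿+-comm)
  open import Algebra.Properties.CommutativeSemigroup +-commutativeSemigroup
    using (interchange)

  Σ-cong : ∀ n {f g : ℕ → Carrier} → (∀ i → i ≤ n → f i ≈ g i) → Σ≤ n f ≈ Σ≤ n g
  Σ-cong zero    f≈g = f≈g 0 z≤n
  Σ-cong (suc n) f≈g = +-cong (Σ-cong n (λ i i≤n → f≈g i (ℕₚ.m≤n⇒m≤1+n i≤n))) (f≈g (suc n) ℕₚ.≤-refl)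

  Σ-+ : ∀ n (f g : ℕ → Carrier) → Σ≤ n (λ i → f i + g i) ≈ Σ≤ n f + Σ≤ n g
  Σ-+ zero    f g = refl
  Σ-+ (suc n) f g = trans (+-congʳ (Σ-+ n f g)) (interchange _ _ _ _)

  Σ-*ˡ : ∀ n c (f : ℕ → Carrier) → c * Σ≤ n f ≈ Σ≤ n (λ i → c * f i)
  Σ-*ˡ zero    c f = refl
  Σ-*ˡ (suc n) c f = trans (distribˡ c _ _) (+-congʳ (Σ-*ˡ n c f))

  Σ-*ʳ : ∀ n c (f : ℕ → Carrier) → Σ≤ n f * c ≈ Σ≤ n (λ i → f i * c)
  Σ-*ʳ n c f = trans (*-comm _ c) (trans (Σ-*ˡ n c f) (Σ-cong n (λ i _ → *-comm c (f i))))

  Σ-neg : ∀ n (f : ℕ → Carrier) → - Σ≤ n f ≈ Σ≤ n (λ i → - f i)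
  Σ-neg zero    f = refl
  Σ-neg (suc n) f = trans (sym (-‿+-comm _ _)) (+-congʳ (Σ-neg n f))

  Σ-zero : ∀ n {f : ℕ → Carrier} → (∀ i → i ≤ n → f i ≈ 0#) → Σ≤ n f ≈ 0#
  Σ-zero zero    f≈0 = f≈0 0 z≤n
  Σ-zero (suc n) f≈0 =
    trans (+-cong (Σ-zero n (λ i i≤n → f≈0 i (ℕₚ.m≤n⇒m≤1+n i≤n))) (f≈0 (suc n) ℕₚ.≤-refl)) (+-identityʳ 0#)

  Σ-first : ∀ n (f : ℕ → Carrier) → Σ≤ (suc n) f ≈ f 0 + Σ≤ n (λ i → f (suc i))
  Σ-first zero    f = refl
  Σ-first (suc n) f = trans (+-congʳ (Σ-first n f)) (+-assoc _ _ _)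

  Σ-swap : ∀ n m (f : ℕ → ℕ → Carrier) →
           Σ≤ n (λ i → Σ≤ m (f i)) ≈ Σ≤ m (λ j → Σ≤ n (λ i → f i j))
  Σ-swap zero    m f = refl
  Σ-swap (suc n) m f = trans (+-congʳ (Σ-swap n m f)) (sym (Σ-+ m _ _))

  Σ-extend : ∀ {m n} {f : ℕ → Carrier} → m ≤ n → (∀ i → m < i → i ≤ n → f i ≈ 0#) →
             Σ≤ m f ≈ Σ≤ n f
  Σ-extend {n = zero} z≤n f≈0 = refl
  Σ-extend {m} {suc n} {f} m≤n f≈0 with ℕₚ.m≤n⇒m<n∨m≡n m≤n
  ... | inj₂ ≡.refl = refl
  ... | inj₁ (s≤s m≤n′) = begin
    Σ≤ m f                  ≈⟨ Σ-extend m≤n′ (λ i m<i i≤n → f≈0 i m<i (ℕₚ.m≤n⇒m≤1+n i≤n)) ⟩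
    Σ≤ n f                  ≈⟨ +-identityʳ _ ⟨
    Σ≤ n f + 0#             ≈⟨ +-congˡ (f≈0 (suc n) (s≤s m≤n′) ℕₚ.≤-refl) ⟨
    Σ≤ n f + f (suc n)      ∎

  Σ-single : ∀ n k {f : ℕ → Carrier} → k ≤ n → (∀ i → i ≤ n → i ≢ k → f i ≈ 0#) →
             Σ≤ n f ≈ f k
  Σ-single zero .zero z≤n f≈0 = refl
  Σ-single (suc n) k k≤ f≈0 with k ℕₚ.≟ suc n
  ... | yes ≡.refl = trans (+-congʳ (Σ-zero n (λ i i≤n → f≈0 i (ℕₚ.m≤n⇒m≤1+n i≤n) (ℕₚ.<⇒≢ (s≤s i≤n)))))
                           (+-identityˡ _)
  ... | no k≢ = trans (+-cong (Σ-single n k (ℕₚ.≤-pred (ℕₚ.≤∧≢⇒< k≤ k≢))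
                                         (λ i i≤n → f≈0 i (ℕₚ.m≤n⇒m≤1+n i≤n)))
                              (f≈0 (suc n) ℕₚ.≤-refl (λ e → k≢ (≡.sym e))))
                      (+-identityʳ _)

  ι-cong : ∀ {m n} → m ≡ n → ι m ≈ ι n
  ι-cong ≡.refl = refl

  ι-1 : ι 1 ≈ 1#
  ι-1 = +-identityʳ 1#

  ι-+ : ∀ m n → ι (m +ℕ n) ≈ ι m + ι n
  ι-+ zero    n = sym (+-identityˡ _)
  ι-+ (suc m) n = trans (+-congˡ (ι-+ m n)) (sym (+-assoc _ _ _))

  ι-* : ∀ m n → ι (m *ℕ n) ≈ ι m * ι n
  ι-* zero    n = sym (zeroˡ _)
  ι-* (suc m) n = begin
    ι (n +ℕ m *ℕ n)       ≈⟨ ι-+ n (m *ℕ n) ⟩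
    ι n + ι (m *ℕ n)      ≈⟨ +-cong (sym (*-identityˡ _)) (ι-* m n) ⟩
    1# * ι n + ι m * ι n  ≈⟨ distribʳ _ _ _ ⟨
    (1# + ι m) * ι n      ∎

  AD : ℕ → (ℕ → ℕ → Carrier) → Carrier
  AD N h = Σ≤ N (λ j → h j (N ∸ j))

  AD-cong : ∀ N {h g : ℕ → ℕ → Carrier} → (∀ a b → a +ℕ b ≡ N → h a b ≈ g a b) → AD N h ≈ AD N g
  AD-cong N h≈g = Σ-cong N (λ j j≤N → h≈g j (N ∸ j) (ℕₚ.m+[n∸m]≡n j≤N))

  AD-first : ∀ N (h : ℕ → ℕ → Carrier) → AD (suc N) h ≈ h 0 (suc N) + AD N (λ a b → h (suc a) b)
  AD-first N h = Σ-first N _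

  AD-last : ∀ N (h : ℕ → ℕ → Carrier) → AD (suc N) h ≈ AD N (λ a b → h a (suc b)) + h (suc N) 0
  AD-last N h = +-cong (Σ-cong N (λ j j≤N → reflexive (≡.cong (h j) (ℕₚ.+-∸-assoc 1 j≤N))))
                       (reflexive (≡.cong (h (suc N)) (ℕₚ.n∸n≡0 N)))

  AD-comm : ∀ N (h : ℕ → ℕ → Carrier) → AD N h ≈ AD N (λ a b → h b a)
  AD-comm zero    h = refl
  AD-comm (suc N) h = begin
    AD (suc N) h                                ≈⟨ AD-first N h ⟩
    h 0 (suc N) + AD N (λ a b → h (suc a) b)    ≈⟨ +-comm _ _ ⟩
    AD N (λ a b → h (suc a) b) + h 0 (suc N)    ≈⟨ +-congʳ (AD-comm N (λ a b → h (suc a) b)) ⟩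
    AD N (λ a b → h (suc b) a) + h 0 (suc N)    ≈⟨ AD-last N (λ a b → h b a) ⟨
    AD (suc N) (λ a b → h b a)                  ∎

  -- Σ_{s+c=N} Σ_{a+b=s} = Σ_{a+t=N} Σ_{b+c=t}: both run over a+b+c = N.
  AD-assoc : ∀ N (h : ℕ → ℕ → ℕ → Carrier) →
    AD N (λ s c → AD s (λ a b → h a b c)) ≈ AD N (λ a t → AD t (λ b c → h a b c))
  AD-assoc zero    h = refl
  AD-assoc (suc N) h = begin
    AD (suc N) (λ s c → AD s (λ a b → h a b c))
      ≈⟨ AD-first N (λ s c → AD s (λ a b → h a b c)) ⟩
    h 0 0 (suc N) + AD N (λ s c → AD (suc s) (λ a b → h a b c))
      ≈⟨ +-congˡ (AD-cong N (λ s c _ → AD-first s (λ a b → h a b c))) ⟩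
    h 0 0 (suc N) + AD N (λ s c → h 0 (suc s) c + AD s (λ a b → h (suc a) b c))
      ≈⟨ +-congˡ (Σ-+ N (λ j → h 0 (suc j) (N ∸ j)) (λ j → AD j (λ a b → h (suc a) b (N ∸ j)))) ⟩
    h 0 0 (suc N) + (AD N (λ s c → h 0 (suc s) c) + AD N (λ s c → AD s (λ a b → h (suc a) b c)))
      ≈⟨ +-assoc _ _ _ ⟨
    (h 0 0 (suc N) + AD N (λ s c → h 0 (suc s) c)) + AD N (λ s c → AD s (λ a b → h (suc a) b c))
      ≈⟨ +-cong (AD-first N (h 0)) (sym (AD-assoc N (λ a → h (suc a)))) ⟨
    AD (suc N) (h 0) + AD N (λ a t → AD t (λ b c → h (suc a) b c))
      ≈⟨ AD-first N (λ a t → AD t (λ b c → h a b c)) ⟨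
    AD (suc N) (λ a t → AD t (λ b c → h a b c)) ∎

  Σ-square : ∀ N (f : ℕ → ℕ → Carrier) → (∀ a b → a ≤ N → N < a +ℕ b → f a b ≈ 0#) →
             Σ≤ N (λ a → Σ≤ N (f a)) ≈ Σ≤ N (λ s → AD s f)
  Σ-square N f f≈0 = begin
    Σ≤ N (λ a → Σ≤ N (f a))                   ≈⟨ Σ-cong N (λ a a≤N → Σ-extend (ℕₚ.m∸n≤m N a) (f≈0′ a a≤N)) ⟨
    AD N (λ a t → AD t (λ b c → f a b))        ≈⟨ AD-assoc N (λ a b c → f a b) ⟨
    Σ≤ N (λ s → AD s f)                       ∎
    where
    f≈0′ : ∀ a → a ≤ N → ∀ b → N ∸ a < b → b ≤ N → f a b ≈ 0#
    f≈0′ a a≤N b lt _ = f≈0 a b a≤N (≡.subst (_< a +ℕ b) (ℕₚ.m+[n∸m]≡n a≤N) (ℕₚ.+-monoʳ-< a lt))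

module Convolution {a ℓ} (R : CommutativeRing a ℓ) where
  open CommutativeRing R hiding (zero)
  open UC R
  open Sums R
  open Binomial using (B; B-sym; B-assoc; B-pascal; B-zeroʳ; C≡B)
  open import Relation.Binary.Reasoning.Setoid setoid
  open import Algebra.Properties.Ring ring using (-‿distribˡ-*; -‿distribʳ-*)
  open import Algebra.Solver.CommutativeMonoid *-commutativeMonoid using (solve; _⊜_)
  open import Algebra.Solver.Monoid.Expression using () renaming (_⊕_ to _⊛_)

  infix 4 _≋_
  _≋_ : Moments → Moments → Set ℓ
  P ≋ Q = ∀ n → P n ≈ Q n

  ≋-refl : ∀ {P} → P ≋ P
  ≋-refl n = refl

  ≋-sym : ∀ {P Q} → P ≋ Q → Q ≋ P
  ≋-sym P≋Q n = sym (P≋Q n)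

  ≋-trans : ∀ {P Q S} → P ≋ Q → Q ≋ S → P ≋ S
  ≋-trans P≋Q Q≋S n = trans (P≋Q n) (Q≋S n)

  ⊕-as-AD : ∀ (P Q : Moments) N → (P ⊕ Q) N ≈ AD N (λ a b → ι (B a b) * (P a * Q b))
  ⊕-as-AD P Q N = Σ-cong N (λ j j≤N → *-congʳ (ι-cong (C≡B j≤N)))

  ⊕-cong : ∀ {P P′ Q Q′} → P ≋ P′ → Q ≋ Q′ → P ⊕ Q ≋ P′ ⊕ Q′
  ⊕-cong P≋P′ Q≋Q′ N = Σ-cong N (λ j _ → *-congˡ (*-cong (P≋P′ j) (Q≋Q′ (N ∸ j))))

  ⊕-congᵇʳ : ∀ P {Q Q′} N → (∀ n → n ≤ N → Q n ≈ Q′ n) → (P ⊕ Q) N ≈ (P ⊕ Q′) N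
  ⊕-congᵇʳ P N Q≈Q′ = Σ-cong N (λ j _ → *-congˡ (*-congˡ (Q≈Q′ (N ∸ j) (ℕₚ.m∸n≤m N j))))

  ⊕-congᵇˡ : ∀ {P P′} Q N → (∀ n → n ≤ N → P n ≈ P′ n) → (P ⊕ Q) N ≈ (P′ ⊕ Q) N
  ⊕-congᵇˡ Q N P≈P′ = Σ-cong N (λ j j≤N → *-congˡ (*-congʳ (P≈P′ j j≤N)))

  ⊕-comm : ∀ P Q → P ⊕ Q ≋ Q ⊕ P
  ⊕-comm P Q N = begin
    (P ⊕ Q) N                                ≈⟨ ⊕-as-AD P Q N ⟩
    AD N (λ a b → ι (B a b) * (P a * Q b))   ≈⟨ AD-comm N (λ a b → ι (B a b) * (P a * Q b)) ⟩
    AD N (λ a b → ι (B b a) * (P b * Q a))   ≈⟨ AD-cong N (λ a b _ → *-cong (ι-cong (B-sym b a)) (*-comm (P b) (Q a))) ⟩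
    AD N (λ a b → ι (B a b) * (Q a * P b))   ≈⟨ ⊕-as-AD Q P N ⟨
    (Q ⊕ P) N                                ∎

  ⊕-assoc : ∀ P Q S → (P ⊕ Q) ⊕ S ≋ P ⊕ (Q ⊕ S)
  ⊕-assoc P Q S N = begin
    ((P ⊕ Q) ⊕ S) N                               ≈⟨ ⊕-as-AD (P ⊕ Q) S N ⟩
    AD N (λ s c → ι (B s c) * ((P ⊕ Q) s * S c))  ≈⟨ AD-cong N (λ s c _ → expandˡ s c) ⟩
    AD N (λ s c → AD s (λ a b → h a b c))         ≈⟨ AD-assoc N h ⟩
    AD N (λ a t → AD t (λ b c → h a b c))         ≈⟨ AD-cong N (λ a t _ → AD-cong t (λ b c _ → h≈g a b c)) ⟩
    AD N (λ a t → AD t (λ b c → g a b c))         ≈⟨ AD-cong N (λ a t _ → expandʳ a t) ⟨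
    AD N (λ a t → ι (B a t) * (P a * (Q ⊕ S) t))  ≈⟨ ⊕-as-AD P (Q ⊕ S) N ⟨
    (P ⊕ (Q ⊕ S)) N                               ∎
    where
    -- the two bracketings as sums over a + b + c = N
    h g : ℕ → ℕ → ℕ → Carrier
    h a b c = ι (B (a +ℕ b) c) * ((ι (B a b) * (P a * Q b)) * S c)
    g a b c = ι (B a (b +ℕ c)) * (P a * (ι (B b c) * (Q b * S c)))
    expandˡ : ∀ s c → ι (B s c) * ((P ⊕ Q) s * S c) ≈ AD s (λ a b → h a b c)
    expandˡ s c = begin
      ι (B s c) * ((P ⊕ Q) s * S c)
        ≈⟨ *-congˡ (*-congʳ (⊕-as-AD P Q s)) ⟩
      ι (B s c) * (AD s (λ a b → ι (B a b) * (P a * Q b)) * S c)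
        ≈⟨ *-congˡ (Σ-*ʳ s (S c) (λ j → ι (B j (s ∸ j)) * (P j * Q (s ∸ j)))) ⟩
      ι (B s c) * AD s (λ a b → (ι (B a b) * (P a * Q b)) * S c)
        ≈⟨ Σ-*ˡ s (ι (B s c)) _ ⟩
      AD s (λ a b → ι (B s c) * ((ι (B a b) * (P a * Q b)) * S c))
        ≈⟨ AD-cong s {g = λ a b → h a b c} (λ a b a+b≡s → *-congʳ (ι-cong (≡.cong (λ u → B u c) (≡.sym a+b≡s)))) ⟩
      AD s (λ a b → h a b c) ∎
    expandʳ : ∀ a t → ι (B a t) * (P a * (Q ⊕ S) t) ≈ AD t (λ b c → g a b c)
    expandʳ a t = begin
      ι (B a t) * (P a * (Q ⊕ S) t)
        ≈⟨ *-congˡ (*-congˡ (⊕-as-AD Q S t)) ⟩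
      ι (B a t) * (P a * AD t (λ b c → ι (B b c) * (Q b * S c)))
        ≈⟨ *-congˡ (Σ-*ˡ t (P a) (λ j → ι (B j (t ∸ j)) * (Q j * S (t ∸ j)))) ⟩
      ι (B a t) * AD t (λ b c → P a * (ι (B b c) * (Q b * S c)))
        ≈⟨ Σ-*ˡ t (ι (B a t)) _ ⟩
      AD t (λ b c → ι (B a t) * (P a * (ι (B b c) * (Q b * S c))))
        ≈⟨ AD-cong t {g = λ b c → g a b c} (λ b c b+c≡t → *-congʳ (ι-cong (≡.cong (B a) (≡.sym b+c≡t)))) ⟩
      AD t (λ b c → g a b c) ∎
    h≈g : ∀ a b c → h a b c ≈ g a b c
    h≈g a b c = begin
      h a b c
        ≈⟨ solve 5 (λ x y p q s → (x ⊛ ((y ⊛ (p ⊛ q)) ⊛ s)) ⊜ ((x ⊛ y) ⊛ (p ⊛ (q ⊛ s)))) refl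
                   (ι (B (a +ℕ b) c)) (ι (B a b)) (P a) (Q b) (S c) ⟩
      (ι (B (a +ℕ b) c) * ι (B a b)) * (P a * (Q b * S c))
        ≈⟨ *-congʳ (trans (sym (ι-* (B (a +ℕ b) c) (B a b))) (trans (ι-cong (B-assoc a b c)) (ι-* (B a (b +ℕ c)) (B b c)))) ⟩
      (ι (B a (b +ℕ c)) * ι (B b c)) * (P a * (Q b * S c))
        ≈⟨ solve 5 (λ x y p q s → ((x ⊛ y) ⊛ (p ⊛ (q ⊛ s))) ⊜ (x ⊛ (p ⊛ (y ⊛ (q ⊛ s))))) refl
                   (ι (B a (b +ℕ c))) (ι (B b c)) (P a) (Q b) (S c) ⟩
      g a b c ∎

  ⊕-identityˡ : ∀ P → ε ⊕ P ≋ P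
  ⊕-identityˡ P N = begin
    (ε ⊕ P) N                  ≈⟨ Σ-single N 0 z≤n (λ i _ i≢0 → off i i≢0) ⟩
    ι (N C 0) * (1# * P N)     ≈⟨ *-cong ι-1 (*-identityˡ _) ⟩
    1# * P N                   ≈⟨ *-identityˡ _ ⟩
    P N                        ∎
    where
    off : ∀ i → i ≢ 0 → ι (N C i) * (ε i * P (N ∸ i)) ≈ 0#
    off zero    i≢0 = ⊥-elim (i≢0 ≡.refl)
    off (suc i) _   = trans (*-congˡ (zeroˡ _)) (zeroʳ _)

  ⊕-identityʳ : ∀ P → P ⊕ ε ≋ P
  ⊕-identityʳ P = ≋-trans (⊕-comm P ε) (⊕-identityˡ P)

  ⊕-lcomm : ∀ P Q S → P ⊕ (Q ⊕ S) ≋ Q ⊕ (P ⊕ S)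
  ⊕-lcomm P Q S = ≋-trans (≋-sym (⊕-assoc P Q S)) (≋-trans (⊕-cong (⊕-comm P Q) (≋-refl {S})) (⊕-assoc Q P S))

  ⊕-interchange : ∀ P Q S V → (P ⊕ Q) ⊕ (S ⊕ V) ≋ (P ⊕ S) ⊕ (Q ⊕ V)
  ⊕-interchange P Q S V =
    ≋-trans (⊕-assoc P Q (S ⊕ V)) (≋-trans (⊕-cong (≋-refl {P}) (⊕-lcomm Q S V)) (≋-sym (⊕-assoc P S (Q ⊕ V))))

  infixl 6 _⊞_ _⊟_
  infixr 7 _·_

  _⊞_ _⊟_ : Moments → Moments → Moments
  (P ⊞ Q) n = P n + Q n
  (P ⊟ Q) n = P n - Q n

  _·_ : Carrier → Moments → Moments
  (c · P) n = c * P n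

  SumM : ℕ → (ℕ → Moments) → Moments
  SumM M F n = Σ≤ M (λ i → F i n)

  ⊕-distribʳ : ∀ P Q S → (P ⊞ Q) ⊕ S ≋ (P ⊕ S) ⊞ (Q ⊕ S)
  ⊕-distribʳ P Q S N = trans (Σ-cong N (λ j _ → trans (*-congˡ (distribʳ _ _ _)) (distribˡ _ _ _))) (Σ-+ N _ _)

  ⊕-subʳ : ∀ P Q S → (P ⊟ Q) ⊕ S ≋ (P ⊕ S) ⊟ (Q ⊕ S)
  ⊕-subʳ P Q S N = trans (⊕-distribʳ P (λ n → - Q n) S N) (+-congˡ negate)
    where
    negate : ((λ n → - Q n) ⊕ S) N ≈ - (Q ⊕ S) N
    negate = sym (trans (Σ-neg N _) (Σ-cong N (λ j _ → trans (-‿distribʳ-* _ _) (*-congˡ (-‿distribˡ-* _ _)))))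

  ⊕-scaleˡ : ∀ c P Q → (c · P) ⊕ Q ≋ c · (P ⊕ Q)
  ⊕-scaleˡ c P Q N = sym (trans (Σ-*ˡ N c _) (Σ-cong N (λ j _ → move c _ _ _)))
    where
    move : ∀ c x y z → c * (x * (y * z)) ≈ x * ((c * y) * z)
    move = solve 4 (λ c x y z → (c ⊛ (x ⊛ (y ⊛ z))) ⊜ (x ⊛ ((c ⊛ y) ⊛ z))) refl

  ⊕-scaleʳ : ∀ c P Q → P ⊕ (c · Q) ≋ c · (P ⊕ Q)
  ⊕-scaleʳ c P Q N = begin
    (P ⊕ (c · Q)) N  ≈⟨ ⊕-comm P (c · Q) N ⟩
    ((c · Q) ⊕ P) N  ≈⟨ ⊕-scaleˡ c Q P N ⟩
    c * (Q ⊕ P) N    ≈⟨ *-congˡ (⊕-comm Q P N) ⟩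
    c * (P ⊕ Q) N    ∎

  ⊕-zeroˡ : ∀ P → (λ _ → 0#) ⊕ P ≋ (λ _ → 0#)
  ⊕-zeroˡ P N = Σ-zero N (λ j _ → trans (*-congˡ (zeroˡ _)) (zeroʳ _))

  ⊕-SumMˡ : ∀ M F S → SumM M F ⊕ S ≋ SumM M (λ i → F i ⊕ S)
  ⊕-SumMˡ M F S N = begin
    Σ≤ N (λ j → ι (N C j) * (Σ≤ M (λ i → F i j) * S (N ∸ j)))
      ≈⟨ Σ-cong N (λ j _ → trans (*-congˡ (Σ-*ʳ M _ _)) (Σ-*ˡ M _ _)) ⟩
    Σ≤ N (λ j → Σ≤ M (λ i → ι (N C j) * (F i j * S (N ∸ j))))
      ≈⟨ Σ-swap N M _ ⟩
    SumM M (λ i → F i ⊕ S) N ∎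

  ⊕-SumMʳ : ∀ M P F → P ⊕ SumM M F ≋ SumM M (λ i → P ⊕ F i)
  ⊕-SumMʳ M P F N = begin
    (P ⊕ SumM M F) N               ≈⟨ ⊕-comm P (SumM M F) N ⟩
    (SumM M F ⊕ P) N               ≈⟨ ⊕-SumMˡ M F P N ⟩
    Σ≤ M (λ i → (F i ⊕ P) N)       ≈⟨ Σ-cong M (λ i _ → ⊕-comm (F i) P N) ⟩
    Σ≤ M (λ i → (P ⊕ F i) N)       ∎

  -- The shift D is differentiation of exponential generating functions.
  D : Moments → Moments
  D P n = P (suc n)

  -- Leibniz rule D(P ⊕ Q) = DP ⊕ Q + P ⊕ DQ, from Pascal's rule for B.
  leibniz : ∀ P Q → D (P ⊕ Q) ≋ (D P ⊕ Q) ⊞ (P ⊕ D Q)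
  leibniz P Q N = begin
    (P ⊕ Q) (suc N)
      ≈⟨ ⊕-as-AD P Q (suc N) ⟩
    AD (suc N) (λ a b → ι (B a b) * (P a * Q b))
      ≈⟨ AD-cong (suc N) {g = λ a b → h₁ a b + h₂ a b} split-term ⟩
    AD (suc N) (λ a b → h₁ a b + h₂ a b)
      ≈⟨ Σ-+ (suc N) _ _ ⟩
    AD (suc N) h₁ + AD (suc N) h₂
      ≈⟨ +-cong (AD-first N h₁) (AD-last N h₂) ⟩
    (h₁ 0 (suc N) + AD N (λ a b → h₁ (suc a) b)) + (AD N (λ a b → h₂ a (suc b)) + h₂ (suc N) 0)
      ≈⟨ +-cong (trans (+-congʳ (zeroˡ _)) (+-identityˡ _)) (trans (+-congˡ (zeroˡ _)) (+-identityʳ _)) ⟩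
    AD N (λ a b → h₁ (suc a) b) + AD N (λ a b → h₂ a (suc b))
      ≈⟨ +-cong (⊕-as-AD (D P) Q N) (⊕-as-AD P (D Q) N) ⟨
    (D P ⊕ Q) N + (P ⊕ D Q) N ∎
    where
    B↓ˡ B↓ʳ : ℕ → ℕ → ℕ
    B↓ˡ zero    b = 0
    B↓ˡ (suc a) b = B a b
    B↓ʳ a zero    = 0
    B↓ʳ a (suc b) = B a b
    h₁ h₂ : ℕ → ℕ → Carrier
    h₁ a b = ι (B↓ˡ a b) * (P a * Q b)
    h₂ a b = ι (B↓ʳ a b) * (P a * Q b)
    split : ∀ a b → a +ℕ b ≡ suc N → B a b ≡ B↓ˡ a b +ℕ B↓ʳ a b
    split zero    (suc b) _ = ≡.refl
    split (suc a) zero    _ = ≡.trans (B-zeroʳ (suc a)) (≡.sym (≡.trans (ℕₚ.+-identityʳ _) (B-zeroʳ a)))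
    split (suc a) (suc b) _ = B-pascal a b
    split-term : ∀ a b → a +ℕ b ≡ suc N → ι (B a b) * (P a * Q b) ≈ h₁ a b + h₂ a b
    split-term a b a+b≡1+N = begin
      ι (B a b) * (P a * Q b)                              ≈⟨ *-congʳ (ι-cong (split a b a+b≡1+N)) ⟩
      ι (B↓ˡ a b +ℕ B↓ʳ a b) * (P a * Q b)                 ≈⟨ *-congʳ (ι-+ (B↓ˡ a b) (B↓ʳ a b)) ⟩
      (ι (B↓ˡ a b) + ι (B↓ʳ a b)) * (P a * Q b)            ≈⟨ distribʳ _ _ _ ⟩
      h₁ a b + h₂ a b                                      ∎

  -- T a: the moments of the monomial t^a/a! (T 0 is the unit ε).
  T : ℕ → Moments
  T zero          = ε
  T (suc a) zero    = 0#
  T (suc a) (suc n) = T a n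

  T-off : ∀ a i → i ≢ a → T a i ≈ 0#
  T-off zero    zero    i≢a = ⊥-elim (i≢a ≡.refl)
  T-off zero    (suc i) _   = refl
  T-off (suc a) zero    _   = refl
  T-off (suc a) (suc i) i≢a = T-off a i (λ i≡a → i≢a (≡.cong suc i≡a))

  T-on : ∀ a → T a a ≈ 1#
  T-on zero    = refl
  T-on (suc a) = T-on a

  T-shift : ∀ i j b → T (i +ℕ j) (i +ℕ b) ≡ T j b
  T-shift zero    j b = ≡.refl
  T-shift (suc i) j b = T-shift i j b

  T-eval : ∀ a b P → (T a ⊕ P) (a +ℕ b) ≈ ι (B a b) * P b
  T-eval a b P = begin
    (T a ⊕ P) (a +ℕ b)
      ≈⟨ Σ-single (a +ℕ b) a (ℕₚ.m≤m+n a b) (λ i _ i≢a → trans (*-congˡ (trans (*-congʳ (T-off a i i≢a)) (zeroˡ _))) (zeroʳ _)) ⟩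
    ι ((a +ℕ b) C a) * (T a a * P (a +ℕ b ∸ a))
      ≈⟨ *-congˡ (*-cong (T-on a) (reflexive (≡.cong P (ℕₚ.m+n∸m≡n a b)))) ⟩
    ι (B a b) * (1# * P b)
      ≈⟨ *-congˡ (*-identityˡ _) ⟩
    ι (B a b) * P b ∎

  T-low : ∀ a n P → n < a → (T a ⊕ P) n ≈ 0#
  T-low a n P n<a = Σ-zero n (λ i i≤n → trans (*-congˡ (trans (*-congʳ (T-off a i (i≢a i≤n))) (zeroˡ _))) (zeroʳ _))
    where
    i≢a : ∀ {i} → i ≤ n → i ≢ a
    i≢a i≤n ≡.refl = ℕₚ.<-irrefl ≡.refl (ℕₚ.≤-<-trans i≤n n<a)

  T-mult : ∀ i j → T i ⊕ T j ≋ ι (B i j) · T (i +ℕ j)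
  T-mult i j n with i ℕₚ.≤? n
  ... | no i≰n = trans (T-low i n (T j) (ℕₚ.≰⇒> i≰n)) (sym (trans (*-congˡ (T-off (i +ℕ j) n n≢i+j)) (zeroʳ _)))
    where
    n≢i+j : n ≢ i +ℕ j
    n≢i+j ≡.refl = i≰n (ℕₚ.m≤m+n i j)
  ... | yes i≤n with ℕₚ.m≤n⇒∃[o]m+o≡n i≤n
  ...   | b , ≡.refl with b ℕₚ.≟ j
  ...     | yes ≡.refl = trans (T-eval i b (T b)) (*-congˡ (reflexive (≡.sym (T-shift i b b))))
  ...     | no b≢j = begin
    (T i ⊕ T j) (i +ℕ b)             ≈⟨ T-eval i b (T j) ⟩
    ι (B i b) * T j b                ≈⟨ *-congˡ (T-off j b b≢j) ⟩
    ι (B i b) * 0#                   ≈⟨ zeroʳ _ ⟩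
    0#                               ≈⟨ zeroʳ _ ⟨
    ι (B i j) * 0#                   ≈⟨ *-congˡ (trans (reflexive (T-shift i j b)) (T-off j b b≢j)) ⟨
    ι (B i j) * T (i +ℕ j) (i +ℕ b)  ∎

module DotPowers {a ℓ} (R : CommutativeRing a ℓ) where
  open CommutativeRing R hiding (zero)
  open UC R
  open Sums R
  open Convolution R
  open import Relation.Binary.Reasoning.Setoid setoid
  open import Algebra.Properties.Ring ring using (-‿+-comm; -‿distribˡ-*; +-cancelˡ)

  shift0-cong : ∀ {p q} → p ≋ q → shift0 p ≋ shift0 q
  shift0-cong p≋q zero    = refl
  shift0-cong p≋q (suc n) = p≋q (suc n)

  powc-cong : ∀ {p q} → p ≋ q → ∀ k → powc p k ≋ powc q k
  powc-cong p≋q zero    = ≋-refl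
  powc-cong p≋q (suc k) = ⊕-cong (shift0-cong p≋q) (powc-cong p≋q k)

  powc-low : ∀ p k n → n < k → powc p k n ≈ 0#
  powc-low p (suc k) n (s≤s n≤k) = Σ-zero n (term n n≤k)
    where
    term : ∀ n → n ≤ k → ∀ j → j ≤ n → ι (n C j) * (shift0 p j * powc p k (n ∸ j)) ≈ 0#
    term n _ zero _ = trans (*-congˡ (zeroˡ _)) (zeroʳ _)
    term (suc n) 1+n≤k (suc j) (s≤s j≤n) =
      trans (*-congˡ (trans (*-congˡ (powc-low p k (n ∸ j) (ℕₚ.<-≤-trans (s≤s (ℕₚ.m∸n≤m n j)) 1+n≤k)))
                            (zeroʳ _)))
            (zeroʳ _)

  split-unit : ∀ p → p 0 ≈ 1# → p ≋ ε ⊞ shift0 p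
  split-unit p p0 zero    = trans p0 (sym (+-identityʳ _))
  split-unit p p0 (suc n) = sym (+-identityˡ _)

  gbinom-zero : ∀ x → gbinom x 0 ≈ 1#
  gbinom-zero (+ n)    = ι-1
  gbinom-zero -[1+ n ] = trans (*-identityˡ _) ι-1

  gbinom↓ : ℤ → ℕ → Carrier
  gbinom↓ x zero    = 0#
  gbinom↓ x (suc k) = gbinom x k

  negate-cancel : ∀ s c → - s * c + s * c ≈ 0#
  negate-cancel s c = trans (+-congʳ (sym (-‿distribˡ-* s c))) (-‿inverseˡ _)

  gbinom-pascal : ∀ x k → gbinom (ℤ.suc x) k ≈ gbinom x k + gbinom↓ x k
  gbinom-pascal x zero = trans (gbinom-zero (ℤ.suc x)) (sym (trans (+-identityʳ _) (gbinom-zero x)))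
  gbinom-pascal (+ n) (suc k) = begin
    ι (suc n C suc k)              ≈⟨ ι-cong (≡.sym (nCk+nC[k+1]≡[n+1]C[k+1] n k)) ⟩
    ι (n C k +ℕ n C suc k)         ≈⟨ ι-+ (n C k) (n C suc k) ⟩
    ι (n C k) + ι (n C suc k)      ≈⟨ +-comm _ _ ⟩
    ι (n C suc k) + ι (n C k)      ∎
  gbinom-pascal -[1+ zero ] (suc k) = sym (begin
    - sgn k * ι (suc k C suc k) + sgn k * ι (k C k)
      ≈⟨ +-congʳ (*-congˡ (ι-cong (≡.trans (nCn≡1 (suc k)) (≡.sym (nCn≡1 k))))) ⟩
    - sgn k * ι (k C k) + sgn k * ι (k C k)
      ≈⟨ negate-cancel (sgn k) (ι (k C k)) ⟩
    0# ∎)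
  gbinom-pascal -[1+ suc n ] (suc k) = sym (begin
    - sgn k * ι ((suc n +ℕ suc k) C suc k) + sgn k * ι ((suc n +ℕ k) C k)
      ≈⟨ +-cong (*-congˡ (trans (ι-cong (≡.sym (nCk+nC[k+1]≡[n+1]C[k+1] (n +ℕ suc k) k))) (ι-+ Y X)))
                (*-congˡ (ι-cong (≡.cong (_C k) (≡.sym (ℕₚ.+-suc n k))))) ⟩
    - sgn k * (ι Y + ι X) + sgn k * ι Y
      ≈⟨ +-congʳ (trans (distribˡ _ _ _) (+-comm _ _)) ⟩
    (- sgn k * ι X + - sgn k * ι Y) + sgn k * ι Y
      ≈⟨ +-assoc _ _ _ ⟩
    - sgn k * ι X + (- sgn k * ι Y + sgn k * ι Y)
      ≈⟨ +-congˡ (negate-cancel (sgn k) (ι Y)) ⟩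
    - sgn k * ι X + 0#
      ≈⟨ +-identityʳ _ ⟩
    - sgn k * ι X ∎)
    where
    X : ℕ
    X = (n +ℕ suc k) C suc k
    Y : ℕ
    Y = (n +ℕ suc k) C k

  dot-cong : ∀ x {p q} → p ≋ q → dot x p ≋ dot x q
  dot-cong x p≋q n = Σ-cong n (λ k _ → *-congˡ (powc-cong p≋q k n))

  dot-congˡ : ∀ {x y} p → x ≡ y → dot x p ≋ dot y p
  dot-congˡ p ≡.refl = ≋-refl

  dot-at-0 : ∀ x p → dot x p 0 ≈ 1#
  dot-at-0 x p = trans (*-identityʳ _) (gbinom-zero x)

  dot-zero : ∀ p → dot (+ 0) p ≋ ε
  dot-zero p n = trans (Σ-single n 0 z≤n (λ k _ k≢0 → off k k≢0)) (trans (*-congʳ ι-1) (*-identityˡ _))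
    where
    off : ∀ k → k ≢ 0 → gbinom (+ 0) k * powc p k n ≈ 0#
    off zero    k≢0 = ⊥-elim (k≢0 ≡.refl)
    off (suc k) _   = zeroˡ _

  dot-truncate : ∀ M x p n → n ≤ M → dot x p n ≈ SumM M (λ k → gbinom x k · powc p k) n
  dot-truncate M x p n n≤M = Σ-extend n≤M (λ k n<k _ → trans (*-congˡ (powc-low p k n n<k)) (zeroʳ _))

  -- p ⊕ x.p = (x+1).p: multiply f^x = Σ binom(x,k)(f-1)^k by f = 1 + (f-1).
  dot-suc : ∀ p → p 0 ≈ 1# → ∀ x → p ⊕ dot x p ≋ dot (ℤ.suc x) p
  dot-suc p p0 x N = begin
    (p ⊕ dot x p) N
      ≈⟨ ⊕-congᵇʳ p N (λ n n≤N → dot-truncate N x p n n≤N) ⟩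
    (p ⊕ SumM N (λ k → gbinom x k · powc p k)) N
      ≈⟨ ⊕-SumMʳ N p (λ k → gbinom x k · powc p k) N ⟩
    Σ≤ N (λ k → (p ⊕ (gbinom x k · powc p k)) N)
      ≈⟨ Σ-cong N (λ k _ → trans (⊕-scaleʳ (gbinom x k) p (powc p k) N) (trans (*-congˡ (p⊕powc k)) (distribˡ _ _ _))) ⟩
    Σ≤ N (λ k → gbinom x k * powc p k N + gbinom x k * powc p (suc k) N)
      ≈⟨ Σ-+ N _ _ ⟩
    Σ≤ N (λ k → gbinom x k * powc p k N) + Σ≤ N (λ k → gbinom x k * powc p (suc k) N)
      ≈⟨ +-congˡ (reindex N) ⟨
    Σ≤ N (λ k → gbinom x k * powc p k N) + Σ≤ N (λ k → gbinom↓ x k * powc p k N)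
      ≈⟨ Σ-+ N _ _ ⟨
    Σ≤ N (λ k → gbinom x k * powc p k N + gbinom↓ x k * powc p k N)
      ≈⟨ Σ-cong N (λ k _ → trans (sym (distribʳ _ _ _)) (*-congʳ (sym (gbinom-pascal x k)))) ⟩
    dot (ℤ.suc x) p N ∎
    where
    p⊕powc : ∀ k → (p ⊕ powc p k) N ≈ powc p k N + powc p (suc k) N
    p⊕powc k = begin
      (p ⊕ powc p k) N                                 ≈⟨ ⊕-cong (split-unit p p0) (≋-refl {powc p k}) N ⟩
      ((ε ⊞ shift0 p) ⊕ powc p k) N                    ≈⟨ ⊕-distribʳ ε (shift0 p) (powc p k) N ⟩
      (ε ⊕ powc p k) N + (shift0 p ⊕ powc p k) N       ≈⟨ +-congʳ (⊕-identityˡ (powc p k) N) ⟩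
      powc p k N + powc p (suc k) N                    ∎
    -- shifting the summation index; the top term vanishes as powc p (N+1) N = 0
    reindex : ∀ N → Σ≤ N (λ k → gbinom↓ x k * powc p k N) ≈ Σ≤ N (λ k → gbinom x k * powc p (suc k) N)
    reindex zero = trans (zeroˡ _) (sym (trans (*-congˡ (powc-low p 1 0 (s≤s z≤n))) (zeroʳ _)))
    reindex (suc N) = begin
      Σ≤ (suc N) (λ k → gbinom↓ x k * powc p k (suc N))
        ≈⟨ trans (Σ-first N _) (trans (+-congʳ (zeroˡ _)) (+-identityˡ _)) ⟩
      Σ≤ N (λ k → gbinom x k * powc p (suc k) (suc N))
        ≈⟨ +-identityʳ _ ⟨
      Σ≤ N (λ k → gbinom x k * powc p (suc k) (suc N)) + 0#
        ≈⟨ +-congˡ (trans (*-congˡ (powc-low p (suc (suc N)) (suc N) ℕₚ.≤-refl)) (zeroʳ _)) ⟨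
      Σ≤ (suc N) (λ k → gbinom x k * powc p (suc k) (suc N)) ∎

  -- (-1).p is the convolution inverse of p, so p can be cancelled.
  ⊕-cancelˡ : ∀ p → p 0 ≈ 1# → ∀ {X Y} → p ⊕ X ≋ p ⊕ Y → X ≋ Y
  ⊕-cancelˡ p p0 {X} {Y} p⊕X≋p⊕Y n = begin
    X n                     ≈⟨ ⊕-identityˡ X n ⟨
    (ε ⊕ X) n               ≈⟨ ⊕-cong (≋-sym inverse) (≋-refl {X}) n ⟩
    ((p⁻¹ ⊕ p) ⊕ X) n       ≈⟨ ⊕-assoc p⁻¹ p X n ⟩
    (p⁻¹ ⊕ (p ⊕ X)) n       ≈⟨ ⊕-cong (≋-refl {p⁻¹}) p⊕X≋p⊕Y n ⟩
    (p⁻¹ ⊕ (p ⊕ Y)) n       ≈⟨ ⊕-assoc p⁻¹ p Y n ⟨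
    ((p⁻¹ ⊕ p) ⊕ Y) n       ≈⟨ ⊕-cong inverse (≋-refl {Y}) n ⟩
    (ε ⊕ Y) n               ≈⟨ ⊕-identityˡ Y n ⟩
    Y n                     ∎
    where
    p⁻¹ : Moments
    p⁻¹ = dot -[1+ 0 ] p
    inverse : p⁻¹ ⊕ p ≋ ε
    inverse = ≋-trans (⊕-comm p⁻¹ p) (≋-trans (dot-suc p p0 -[1+ 0 ]) (dot-zero p))

  ℤ-induction : ∀ {q} (Q : ℤ → Set q) → Q (+ 0) → (∀ x → Q x → Q (ℤ.suc x)) → (∀ x → Q x → Q (ℤ.pred x)) →
                ∀ x → Q x
  ℤ-induction Q base up down (+ zero)     = base
  ℤ-induction Q base up down (+ suc n)    = up (+ n) (ℤ-induction Q base up down (+ n))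
  ℤ-induction Q base up down -[1+ zero ]  = down (+ 0) base
  ℤ-induction Q base up down -[1+ suc n ] = down -[1+ n ] (ℤ-induction Q base up down -[1+ n ])

  dot-+ : ∀ p → p 0 ≈ 1# → ∀ x y → dot x p ⊕ dot y p ≋ dot (x ℤ.+ y) p
  dot-+ p p0 x = ℤ-induction (λ y → dot x p ⊕ dot y p ≋ dot (x ℤ.+ y) p) base up down
    where
    suc-inside : ∀ y → x ℤ.+ ℤ.suc y ≡ ℤ.suc (x ℤ.+ y)
    suc-inside y = ≡.trans (≡.sym (ℤₚ.+-assoc x ℤ.1ℤ y))
                           (≡.trans (≡.cong (ℤ._+ y) (ℤₚ.+-comm x ℤ.1ℤ)) (ℤₚ.+-assoc ℤ.1ℤ x y))
    base : dot x p ⊕ dot (+ 0) p ≋ dot (x ℤ.+ + 0) p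
    base n = begin
      (dot x p ⊕ dot (+ 0) p) n  ≈⟨ ⊕-cong (≋-refl {dot x p}) (dot-zero p) n ⟩
      (dot x p ⊕ ε) n            ≈⟨ ⊕-identityʳ (dot x p) n ⟩
      dot x p n                  ≈⟨ dot-congˡ p (≡.sym (ℤₚ.+-identityʳ x)) n ⟩
      dot (x ℤ.+ + 0) p n        ∎
    up : ∀ y → dot x p ⊕ dot y p ≋ dot (x ℤ.+ y) p → dot x p ⊕ dot (ℤ.suc y) p ≋ dot (x ℤ.+ ℤ.suc y) p
    up y ih n = begin
      (dot x p ⊕ dot (ℤ.suc y) p) n     ≈⟨ ⊕-cong (≋-refl {dot x p}) (≋-sym (dot-suc p p0 y)) n ⟩
      (dot x p ⊕ (p ⊕ dot y p)) n       ≈⟨ ⊕-lcomm (dot x p) p (dot y p) n ⟩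
      (p ⊕ (dot x p ⊕ dot y p)) n       ≈⟨ ⊕-cong (≋-refl {p}) ih n ⟩
      (p ⊕ dot (x ℤ.+ y) p) n           ≈⟨ dot-suc p p0 (x ℤ.+ y) n ⟩
      dot (ℤ.suc (x ℤ.+ y)) p n         ≈⟨ dot-congˡ p (≡.sym (suc-inside y)) n ⟩
      dot (x ℤ.+ ℤ.suc y) p n           ∎
    down : ∀ y → dot x p ⊕ dot y p ≋ dot (x ℤ.+ y) p → dot x p ⊕ dot (ℤ.pred y) p ≋ dot (x ℤ.+ ℤ.pred y) p
    down y ih = ⊕-cancelˡ p p0 λ n → begin
      (p ⊕ (dot x p ⊕ dot z p)) n       ≈⟨ ⊕-lcomm p (dot x p) (dot z p) n ⟩
      (dot x p ⊕ (p ⊕ dot z p)) n       ≈⟨ ⊕-cong (≋-refl {dot x p}) (dot-suc p p0 z) n ⟩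
      (dot x p ⊕ dot (ℤ.suc z) p) n     ≈⟨ ⊕-cong (≋-refl {dot x p}) (dot-congˡ p (ℤₚ.suc-pred y)) n ⟩
      (dot x p ⊕ dot y p) n             ≈⟨ ih n ⟩
      dot (x ℤ.+ y) p n                 ≈⟨ dot-congˡ p (≡.trans (≡.cong (λ t → x ℤ.+ t) (≡.sym (ℤₚ.suc-pred y))) (suc-inside z)) n ⟩
      dot (ℤ.suc (x ℤ.+ z)) p n         ≈⟨ dot-suc p p0 (x ℤ.+ z) n ⟨
      (p ⊕ dot (x ℤ.+ z) p) n           ∎
      where
      z : ℤ
      z = ℤ.pred y

  ιℤ : ℤ → Carrier
  ιℤ (+ n)    = ι n
  ιℤ -[1+ n ] = - ι (suc n)

  ιℤ-suc : ∀ x → ιℤ (ℤ.suc x) ≈ 1# + ιℤ x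
  ιℤ-suc (+ n) = refl
  ιℤ-suc -[1+ zero ] = sym (trans (+-congˡ (-‿cong ι-1)) (-‿inverseʳ 1#))
  ιℤ-suc -[1+ suc n ] = sym (begin
    1# + - (1# + ι (suc n))      ≈⟨ +-congˡ (sym (-‿+-comm 1# _)) ⟩
    1# + (- 1# + - ι (suc n))    ≈⟨ +-assoc _ _ _ ⟨
    (1# + - 1#) + - ι (suc n)    ≈⟨ +-congʳ (-‿inverseʳ 1#) ⟩
    0# + - ι (suc n)             ≈⟨ +-identityˡ _ ⟩
    - ι (suc n)                  ∎)

  -- Chain rule D(x.λ) = x · ((x-1).λ ⊕ Dλ), by induction on x: each step is
  -- the Leibniz rule applied to λ ⊕ (x-1).λ = x.λ.
  dot-chain : ∀ lam → lam 0 ≈ 1# → ∀ x → D (dot x lam) ≋ ιℤ x · (dot (ℤ.pred x) lam ⊕ D lam)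
  dot-chain lam lam0 = ℤ-induction Chain base up down
    where
    Chain : ℤ → Set ℓ
    Chain x = D (dot x lam) ≋ ιℤ x · (dot (ℤ.pred x) lam ⊕ D lam)
    Z : ℤ → Moments
    Z x = dot x lam ⊕ D lam
    lam⊕pred : ∀ x → lam ⊕ dot (ℤ.pred x) lam ≋ dot x lam
    lam⊕pred x = ≋-trans (dot-suc lam lam0 (ℤ.pred x)) (dot-congˡ lam (ℤₚ.suc-pred x))
    absorb : ∀ c x → lam ⊕ (c · Z (ℤ.pred x)) ≋ c · Z x
    absorb c x n = trans (⊕-scaleʳ c lam (Z (ℤ.pred x)) n)
      (*-congˡ (trans (sym (⊕-assoc lam (dot (ℤ.pred x) lam) (D lam) n)) (⊕-cong (lam⊕pred x) (≋-refl {D lam}) n)))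
    leibniz-step : ∀ y → D (dot (ℤ.suc y) lam) ≋ Z y ⊞ (lam ⊕ D (dot y lam))
    leibniz-step y n = begin
      D (dot (ℤ.suc y) lam) n                            ≈⟨ dot-suc lam lam0 y (suc n) ⟨
      D (lam ⊕ dot y lam) n                              ≈⟨ leibniz lam (dot y lam) n ⟩
      (D lam ⊕ dot y lam) n + (lam ⊕ D (dot y lam)) n    ≈⟨ +-congʳ (⊕-comm (D lam) (dot y lam) n) ⟩
      Z y n + (lam ⊕ D (dot y lam)) n                    ∎
    base : Chain (+ 0)
    base n = trans (dot-zero lam (suc n)) (sym (zeroˡ _))
    up : ∀ x → Chain x → Chain (ℤ.suc x)
    up x ih n = begin
      D (dot (ℤ.suc x) lam) n                       ≈⟨ leibniz-step x n ⟩
      Z x n + (lam ⊕ D (dot x lam)) n               ≈⟨ +-congˡ (trans (⊕-cong (≋-refl {lam}) ih n) (absorb (ιℤ x) x n)) ⟩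
      Z x n + ιℤ x * Z x n                          ≈⟨ +-congʳ (*-identityˡ _) ⟨
      1# * Z x n + ιℤ x * Z x n                     ≈⟨ distribʳ _ _ _ ⟨
      (1# + ιℤ x) * Z x n                           ≈⟨ *-congʳ (ιℤ-suc x) ⟨
      ιℤ (ℤ.suc x) * Z x n                          ≈⟨ *-congˡ (⊕-cong (dot-congˡ lam (≡.sym (ℤₚ.pred-suc x))) (≋-refl {D lam}) n) ⟩
      ιℤ (ℤ.suc x) * Z (ℤ.pred (ℤ.suc x)) n         ∎
    -- from D(x.λ) = Z(y) + λ ⊕ D(y.λ) and D(x.λ) = (1 + y) Z(y), where y = x - 1
    down : ∀ x → Chain x → Chain (ℤ.pred x)
    down x ih = ⊕-cancelˡ lam lam0 (λ n → trans (step n) (sym (absorb (ιℤ y) y n)))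
      where
      y : ℤ
      y = ℤ.pred x
      step : ∀ n → (lam ⊕ D (dot y lam)) n ≈ ιℤ y * Z y n
      step n = +-cancelˡ (Z y n) _ _ (begin
        Z y n + (lam ⊕ D (dot y lam)) n   ≈⟨ leibniz-step y n ⟨
        D (dot (ℤ.suc y) lam) n           ≈⟨ dot-congˡ lam (ℤₚ.suc-pred x) (suc n) ⟩
        D (dot x lam) n                   ≈⟨ ih n ⟩
        ιℤ x * Z y n                      ≈⟨ *-congʳ (trans (reflexive (≡.cong ιℤ (≡.sym (ℤₚ.suc-pred x)))) (ιℤ-suc y)) ⟩
        (1# + ιℤ y) * Z y n               ≈⟨ distribʳ _ _ _ ⟩
        1# * Z y n + ιℤ y * Z y n         ≈⟨ +-congʳ (*-identityˡ _) ⟩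
        Z y n + ιℤ y * Z y n              ∎)

-- U i has generating
-- function (t f_λ(t))^i / i!, and comp K has generating function
-- f_K(t f_λ(t)); comp is a ring homomorphism, so it commutes with dot
-- products.  The coefficient functional Λ p A = p! [t^p] A'(t) f_λ(t)^(-p-1)
-- satisfies Λ p (U i) = δ_{i,p+1}, whence Λ p (comp K) = K (p+1).  Since
-- 𝔎_{α,λ} (p+1) is by definition Λ p α, and Λ detects sequences vanishing
-- at 0, comp 𝔎_{α,λ} = α: this is Lagrange inversion.
module Composition {a ℓ} (R : CommutativeRing a ℓ) where
  open CommutativeRing R hiding (zero)
  open UC R
  open Sums R
  open Convolution R
  open DotPowers R
  open Binomial using (B; B-absorb; B-zeroʳ; C≡B)
  open import Relation.Binary.Reasoning.Setoid setoid
  open import Algebra.Properties.Ring ring using (-‿distribˡ-*; -‿distribʳ-*)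
  open import Algebra.Properties.CommutativeSemigroup *-commutativeSemigroup using (x∙yz≈y∙xz)
  open import Algebra.Solver.CommutativeMonoid *-commutativeMonoid using (solve; _⊜_)
  open import Algebra.Solver.Monoid.Expression using () renaming (_⊕_ to _⊛_)

  offset : ∀ a r → + a ℤ.+ -[1+ a +ℕ r ] ≡ -[1+ r ]
  offset a r = ≡.trans (≡.cong₂ ℤ._⊖_ (≡.sym (ℕₚ.+-identityʳ a)) (≡.sym (ℕₚ.+-suc a r)))
                       (ℤₚ.+-cancelˡ-⊖ a 0 (suc r))

  module _ (lam : Moments) (lam0 : lam 0 ≈ 1#) where

    U : ℕ → Moments
    U i = T i ⊕ dot (+ i) lam

    U-low : ∀ i n → n < i → U i n ≈ 0#
    U-low i n = T-low i n (dot (+ i) lam)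

    U-zero : U 0 ≋ ε
    U-zero = ≋-trans (⊕-cong ≋-refl (dot-zero lam)) (⊕-identityˡ ε)

    U-mult : ∀ i j → U i ⊕ U j ≋ ι (B i j) · U (i +ℕ j)
    U-mult i j = ≋-trans (⊕-interchange (T i) (dot (+ i) lam) (T j) (dot (+ j) lam))
      (≋-trans (⊕-cong (T-mult i j) (dot-+ lam lam0 (+ i) (+ j)))
               (⊕-scaleˡ (ι (B i j)) (T (i +ℕ j)) (dot (+ (i +ℕ j)) lam)))

    comp : Moments → Moments
    comp K n = Σ≤ n (λ i → K i * U i n)

    comp-truncate : ∀ M K n → n ≤ M → comp K n ≈ SumM M (λ i → K i · U i) n
    comp-truncate M K n n≤M = Σ-extend n≤M (λ i n<i _ → trans (*-congˡ (U-low i n n<i)) (zeroʳ _))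

    comp-ε : comp ε ≋ ε
    comp-ε n = trans (Σ-single n 0 z≤n (λ i _ i≢0 → off i i≢0)) (trans (*-identityˡ _) (U-zero n))
      where
      off : ∀ i → i ≢ 0 → ε i * U i n ≈ 0#
      off zero    i≢0 = ⊥-elim (i≢0 ≡.refl)
      off (suc i) _   = zeroˡ _

    comp-shift0 : ∀ K → comp (shift0 K) ≋ shift0 (comp K)
    comp-shift0 K zero    = zeroˡ _
    comp-shift0 K (suc N) = begin
      comp (shift0 K) (suc N)                   ≈⟨ Σ-first N _ ⟩
      0# * U 0 (suc N) + higher                 ≈⟨ +-congʳ (zeroˡ _) ⟩
      0# + higher                               ≈⟨ +-congʳ (trans (*-congˡ (U-zero (suc N))) (zeroʳ _)) ⟨
      K 0 * U 0 (suc N) + higher                ≈⟨ Σ-first N _ ⟨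
      comp K (suc N)                            ∎
      where
      higher : Carrier
      higher = Σ≤ N (λ i → K (suc i) * U (suc i) (suc N))

    -- comp is multiplicative: both sides are Σ_{i,j} P i Q j B i j U (i+j).
    comp-mult : ∀ P Q → comp P ⊕ comp Q ≋ comp (P ⊕ Q)
    comp-mult P Q N = begin
      (comp P ⊕ comp Q) N
        ≈⟨ trans (⊕-congᵇʳ (comp P) N (λ n n≤N → comp-truncate N Q n n≤N))
                 (⊕-congᵇˡ (SumM N Qᵤ) N (λ n n≤N → comp-truncate N P n n≤N)) ⟩
      (SumM N Pᵤ ⊕ SumM N Qᵤ) N
        ≈⟨ ⊕-SumMˡ N Pᵤ (SumM N Qᵤ) N ⟩
      Σ≤ N (λ i → (Pᵤ i ⊕ SumM N Qᵤ) N)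
        ≈⟨ Σ-cong N (λ i _ → trans (⊕-scaleˡ (P i) (U i) (SumM N Qᵤ) N) (*-congˡ (⊕-SumMʳ N (U i) Qᵤ N))) ⟩
      Σ≤ N (λ i → P i * Σ≤ N (λ j → (U i ⊕ Qᵤ j) N))
        ≈⟨ Σ-cong N (λ i _ → trans (Σ-*ˡ N (P i) _) (Σ-cong N (λ j _ → *-congˡ (UQ i j)))) ⟩
      Σ≤ N (λ i → Σ≤ N (f i))
        ≈⟨ Σ-square N f f-vanishes ⟩
      Σ≤ N (λ s → AD s f)
        ≈⟨ Σ-cong N (λ s _ → trans (AD-cong s (λ i j i+j≡s → regroup i j s i+j≡s)) (sym (Σ-*ʳ s (U s N) _))) ⟩
      Σ≤ N (λ s → AD s (λ i j → ι (B i j) * (P i * Q j)) * U s N)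
        ≈⟨ Σ-cong N (λ s _ → *-congʳ (⊕-as-AD P Q s)) ⟨
      comp (P ⊕ Q) N ∎
      where
      Pᵤ Qᵤ : ℕ → Moments
      Pᵤ i = P i · U i
      Qᵤ j = Q j · U j
      f : ℕ → ℕ → Carrier
      f i j = P i * (Q j * (ι (B i j) * U (i +ℕ j) N))
      UQ : ∀ i j → (U i ⊕ Qᵤ j) N ≈ Q j * (ι (B i j) * U (i +ℕ j) N)
      UQ i j = trans (⊕-scaleʳ (Q j) (U i) (U j) N) (*-congˡ (U-mult i j N))
      f-vanishes : ∀ i j → i ≤ N → N < i +ℕ j → f i j ≈ 0#
      f-vanishes i j _ N<i+j =
        trans (*-congˡ (trans (*-congˡ (trans (*-congˡ (U-low (i +ℕ j) N N<i+j)) (zeroʳ _))) (zeroʳ _))) (zeroʳ _)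
      regroup : ∀ i j s → i +ℕ j ≡ s → f i j ≈ (ι (B i j) * (P i * Q j)) * U s N
      regroup i j s ≡.refl = solve 4 (λ p q b u → (p ⊛ (q ⊛ (b ⊛ u))) ⊜ ((b ⊛ (p ⊛ q)) ⊛ u)) refl
                                     (P i) (Q j) (ι (B i j)) (U (i +ℕ j) N)

    comp-powc : ∀ K k → comp (powc K k) ≋ powc (comp K) k
    comp-powc K zero    = comp-ε
    comp-powc K (suc k) = ≋-trans (≋-sym (comp-mult (shift0 K) (powc K k)))
                                  (⊕-cong (comp-shift0 K) (comp-powc K k))

    comp-dot : ∀ m K → comp (dot m K) ≋ dot m (comp K)
    comp-dot m K N = begin
      Σ≤ N (λ i → dot m K i * U i N)
        ≈⟨ Σ-cong N (λ i i≤N → trans (*-congʳ (dot-truncate N m K i i≤N)) (Σ-*ʳ N (U i N) _)) ⟩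
      Σ≤ N (λ i → Σ≤ N (λ k → gbinom m k * powc K k i * U i N))
        ≈⟨ Σ-swap N N _ ⟩
      Σ≤ N (λ k → Σ≤ N (λ i → gbinom m k * powc K k i * U i N))
        ≈⟨ Σ-cong N (λ k _ → trans (Σ-cong N (λ i _ → *-assoc _ _ _)) (sym (Σ-*ˡ N (gbinom m k) _))) ⟩
      Σ≤ N (λ k → gbinom m k * comp (powc K k) N)
        ≈⟨ Σ-cong N (λ k _ → *-congˡ (comp-powc K k N)) ⟩
      dot m (comp K) N ∎

    Λ : ℕ → Moments → Carrier
    Λ p A = (D A ⊕ dot -[1+ p ] lam) p

    Λ-U-zero : ∀ p → Λ p (U 0) ≈ 0#
    Λ-U-zero p = trans (⊕-congᵇˡ (dot -[1+ p ] lam) p (λ n _ → U-zero (suc n))) (⊕-zeroˡ (dot -[1+ p ] lam) p)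

    -- (t^(a+1)/(a+1)! f^(a+1))' f^(-p-1) = t^a/a! f^(a-p) + (a+1) t^(a+1)/(a+1)! f^(a-p-1) f'
    Λ-U-suc : ∀ i p → Λ p (U (suc i)) ≈ (T i ⊕ dot (+ suc i ℤ.+ -[1+ p ]) lam) p
                                         + ι (suc i) * (T (suc i) ⊕ (dot (+ i ℤ.+ -[1+ p ]) lam ⊕ D lam)) p
    Λ-U-suc i p = begin
      (D (U (suc i)) ⊕ W) p
        ≈⟨ ⊕-cong (leibniz (T (suc i)) (dot (+ suc i) lam)) (≋-refl {W}) p ⟩
      (((T i ⊕ dot (+ suc i) lam) ⊞ (T (suc i) ⊕ D (dot (+ suc i) lam))) ⊕ W) p
        ≈⟨ ⊕-distribʳ (T i ⊕ dot (+ suc i) lam) (T (suc i) ⊕ D (dot (+ suc i) lam)) W p ⟩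
      ((T i ⊕ dot (+ suc i) lam) ⊕ W) p + ((T (suc i) ⊕ D (dot (+ suc i) lam)) ⊕ W) p
        ≈⟨ +-cong first second ⟩
      _ ∎
      where
      W : Moments
      W = dot -[1+ p ] lam
      first : ((T i ⊕ dot (+ suc i) lam) ⊕ W) p ≈ (T i ⊕ dot (+ suc i ℤ.+ -[1+ p ]) lam) p
      first = trans (⊕-assoc (T i) (dot (+ suc i) lam) W p) (⊕-cong (≋-refl {T i}) (dot-+ lam lam0 (+ suc i) -[1+ p ]) p)
      Zi : Moments
      Zi = dot (+ i) lam ⊕ D lam
      Zi⊕W : Zi ⊕ W ≋ dot (+ i ℤ.+ -[1+ p ]) lam ⊕ D lam
      Zi⊕W n = begin
        (Zi ⊕ W) n                          ≈⟨ ⊕-assoc (dot (+ i) lam) (D lam) W n ⟩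
        (dot (+ i) lam ⊕ (D lam ⊕ W)) n     ≈⟨ ⊕-cong (≋-refl {dot (+ i) lam}) (⊕-comm (D lam) W) n ⟩
        (dot (+ i) lam ⊕ (W ⊕ D lam)) n     ≈⟨ ⊕-assoc (dot (+ i) lam) W (D lam) n ⟨
        ((dot (+ i) lam ⊕ W) ⊕ D lam) n     ≈⟨ ⊕-cong (dot-+ lam lam0 (+ i) -[1+ p ]) (≋-refl {D lam}) n ⟩
        (dot (+ i ℤ.+ -[1+ p ]) lam ⊕ D lam) n ∎
      second : ((T (suc i) ⊕ D (dot (+ suc i) lam)) ⊕ W) p
               ≈ ι (suc i) * (T (suc i) ⊕ (dot (+ i ℤ.+ -[1+ p ]) lam ⊕ D lam)) p
      second = begin
        ((T (suc i) ⊕ D (dot (+ suc i) lam)) ⊕ W) p ≈⟨ ⊕-assoc (T (suc i)) (D (dot (+ suc i) lam)) W p ⟩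
        (T (suc i) ⊕ (D (dot (+ suc i) lam) ⊕ W)) p
          ≈⟨ ⊕-cong (≋-refl {T (suc i)}) (⊕-cong (dot-chain lam lam0 (+ suc i)) (≋-refl {W})) p ⟩
        (T (suc i) ⊕ ((ι (suc i) · Zi) ⊕ W)) p      ≈⟨ ⊕-cong (≋-refl {T (suc i)}) (⊕-scaleˡ (ι (suc i)) Zi W) p ⟩
        (T (suc i) ⊕ (ι (suc i) · (Zi ⊕ W))) p      ≈⟨ ⊕-scaleʳ (ι (suc i)) (T (suc i)) (Zi ⊕ W) p ⟩
        ι (suc i) * (T (suc i) ⊕ (Zi ⊕ W)) p        ≈⟨ *-congˡ (⊕-cong (≋-refl {T (suc i)}) Zi⊕W p) ⟩
        ι (suc i) * (T (suc i) ⊕ (dot (+ i ℤ.+ -[1+ p ]) lam ⊕ D lam)) p ∎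

    Λ-U-above : ∀ i p → p < i → Λ p (U (suc i)) ≈ 0#
    Λ-U-above i p p<i = begin
      Λ p (U (suc i))                                  ≈⟨ Λ-U-suc i p ⟩
      (T i ⊕ E₁) p + ι (suc i) * (T (suc i) ⊕ E₂) p    ≈⟨ +-cong (T-low i p E₁ p<i) (*-congˡ (T-low (suc i) p E₂ (ℕₚ.m<n⇒m<1+n p<i))) ⟩
      0# + ι (suc i) * 0#                              ≈⟨ trans (+-identityˡ _) (zeroʳ _) ⟩
      0#                                               ∎
      where
      E₁ : Moments
      E₁ = dot (+ suc i ℤ.+ -[1+ p ]) lam
      E₂ : Moments
      E₂ = dot (+ i ℤ.+ -[1+ p ]) lam ⊕ D lam

    Λ-U-diagonal : ∀ p → Λ p (U (suc p)) ≈ 1#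
    Λ-U-diagonal p = begin
      Λ p (U (suc p))
        ≈⟨ Λ-U-suc p p ⟩
      (T p ⊕ E₁) p + ι (suc p) * (T (suc p) ⊕ E₂) p
        ≈⟨ +-cong (reflexive (≡.cong (T p ⊕ E₁) (≡.sym (ℕₚ.+-identityʳ p))))
                  (*-congˡ (T-low (suc p) p E₂ ℕₚ.≤-refl)) ⟩
      (T p ⊕ E₁) (p +ℕ 0) + ι (suc p) * 0#
        ≈⟨ +-cong (T-eval p 0 E₁) (zeroʳ _) ⟩
      ι (B p 0) * E₁ 0 + 0#
        ≈⟨ trans (+-identityʳ _) (*-cong (trans (ι-cong (B-zeroʳ p)) ι-1) (dot-at-0 (+ suc p ℤ.+ -[1+ p ]) lam)) ⟩
      1# * 1#
        ≈⟨ *-identityˡ 1# ⟩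
      1# ∎
      where
      E₁ : Moments
      E₁ = dot (+ suc p ℤ.+ -[1+ p ]) lam
      E₂ : Moments
      E₂ = dot (+ p ℤ.+ -[1+ p ]) lam ⊕ D lam

    -- For p = i + r + 1 > i the two terms of Λ-U-suc cancel: by the chain
    -- rule both are multiples of V = ((-(r+2)).λ ⊕ Dλ) r, with coefficients
    -- -(r+1) B i (r+1) and (i+1) B (i+1) r, which agree by absorption.
    Λ-U-below : ∀ i r → Λ (suc i +ℕ r) (U (suc i)) ≈ 0#
    Λ-U-below i r = begin
      Λ p (U (suc i))
        ≈⟨ Λ-U-suc i p ⟩
      (T i ⊕ dot (+ suc i ℤ.+ -[1+ p ]) lam) p + ι (suc i) * (T (suc i) ⊕ (dot (+ i ℤ.+ -[1+ p ]) lam ⊕ D lam)) p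
        ≈⟨ +-cong first second ⟩
      - (ι (suc r *ℕ B i (suc r)) * V) + ι (suc i *ℕ B (suc i) r) * V
        ≈⟨ +-congˡ (*-congʳ (ι-cong (≡.sym (B-absorb i r)))) ⟩
      - (ι (suc r *ℕ B i (suc r)) * V) + ι (suc r *ℕ B i (suc r)) * V
        ≈⟨ -‿inverseˡ _ ⟩
      0# ∎
      where
      p : ℕ
      p = suc i +ℕ r
      V : Carrier
      V = (dot -[1+ suc r ] lam ⊕ D lam) r
      i+1+r : i +ℕ suc r ≡ p
      i+1+r = ℕₚ.+-suc i r
      exponent : + i ℤ.+ -[1+ p ] ≡ -[1+ suc r ]
      exponent = ≡.trans (≡.cong (λ n → + i ℤ.+ -[1+ n ]) (≡.sym i+1+r)) (offset i (suc r))
      first : (T i ⊕ dot (+ suc i ℤ.+ -[1+ p ]) lam) p ≈ - (ι (suc r *ℕ B i (suc r)) * V)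
      first = begin
        (T i ⊕ dot (+ suc i ℤ.+ -[1+ p ]) lam) p      ≈⟨ ⊕-cong (≋-refl {T i}) (dot-congˡ lam (offset (suc i) r)) p ⟩
        (T i ⊕ dot -[1+ r ] lam) p                     ≈⟨ reflexive (≡.cong (T i ⊕ dot -[1+ r ] lam) (≡.sym i+1+r)) ⟩
        (T i ⊕ dot -[1+ r ] lam) (i +ℕ suc r)          ≈⟨ T-eval i (suc r) (dot -[1+ r ] lam) ⟩
        ι (B i (suc r)) * dot -[1+ r ] lam (suc r)     ≈⟨ *-congˡ (dot-chain lam lam0 -[1+ r ] r) ⟩
        ι (B i (suc r)) * (- ι (suc r) * V)           ≈⟨ *-congˡ (sym (-‿distribˡ-* _ _)) ⟩
        ι (B i (suc r)) * - (ι (suc r) * V)           ≈⟨ sym (-‿distribʳ-* _ _) ⟩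
        - (ι (B i (suc r)) * (ι (suc r) * V))         ≈⟨ -‿cong (trans (x∙yz≈y∙xz _ _ _) (sym (*-assoc _ _ _))) ⟩
        - ((ι (suc r) * ι (B i (suc r))) * V)         ≈⟨ -‿cong (*-congʳ (sym (ι-* (suc r) (B i (suc r))))) ⟩
        - (ι (suc r *ℕ B i (suc r)) * V)              ∎
      second : ι (suc i) * (T (suc i) ⊕ (dot (+ i ℤ.+ -[1+ p ]) lam ⊕ D lam)) p ≈ ι (suc i *ℕ B (suc i) r) * V
      second = begin
        ι (suc i) * (T (suc i) ⊕ (dot (+ i ℤ.+ -[1+ p ]) lam ⊕ D lam)) p
          ≈⟨ *-congˡ (⊕-cong (≋-refl {T (suc i)}) (⊕-cong (dot-congˡ lam exponent) (≋-refl {D lam})) p) ⟩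
        ι (suc i) * (T (suc i) ⊕ (dot -[1+ suc r ] lam ⊕ D lam)) (suc i +ℕ r)
          ≈⟨ *-congˡ (T-eval (suc i) r (dot -[1+ suc r ] lam ⊕ D lam)) ⟩
        ι (suc i) * (ι (B (suc i) r) * V)
          ≈⟨ sym (*-assoc _ _ _) ⟩
        (ι (suc i) * ι (B (suc i) r)) * V
          ≈⟨ *-congʳ (sym (ι-* (suc i) (B (suc i) r))) ⟩
        ι (suc i *ℕ B (suc i) r) * V ∎

    Λ-U-off : ∀ p i → i ≢ suc p → Λ p (U i) ≈ 0#
    Λ-U-off p zero    _ = Λ-U-zero p
    Λ-U-off p (suc i) i+1≢p+1 with ℕₚ.<-cmp i p
    ... | tri< i<p _ _ with ℕₚ.m≤n⇒∃[o]m+o≡n i<p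
    ...   | r , ≡.refl = Λ-U-below i r
    Λ-U-off p (suc i) i+1≢p+1 | tri≈ _ ≡.refl _ = ⊥-elim (i+1≢p+1 ≡.refl)
    Λ-U-off p (suc i) i+1≢p+1 | tri> _ _ p<i = Λ-U-above i p p<i

    Λ-comp : ∀ K p → Λ p (comp K) ≈ K (suc p)
    Λ-comp K p = begin
      Λ p (comp K)
        ≈⟨ ⊕-congᵇˡ W p (λ n n≤p → comp-truncate (suc p) K (suc n) (s≤s n≤p)) ⟩
      Λ p (SumM (suc p) (λ i → K i · U i))
        ≈⟨ ⊕-SumMˡ (suc p) (λ i → K i · D (U i)) W p ⟩
      Σ≤ (suc p) (λ i → ((K i · D (U i)) ⊕ W) p)
        ≈⟨ Σ-cong (suc p) (λ i _ → ⊕-scaleˡ (K i) (D (U i)) W p) ⟩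
      Σ≤ (suc p) (λ i → K i * Λ p (U i))
        ≈⟨ Σ-single (suc p) (suc p) ℕₚ.≤-refl (λ i _ i≢p+1 → trans (*-congˡ (Λ-U-off p i i≢p+1)) (zeroʳ _)) ⟩
      K (suc p) * Λ p (U (suc p))
        ≈⟨ trans (*-congˡ (Λ-U-diagonal p)) (*-identityʳ _) ⟩
      K (suc p) ∎
      where
      W : Moments
      W = dot -[1+ p ] lam

    -- A sequence with A 0 = 0 and all Λ p A = 0 vanishes: Λ n A is A (n+1)
    -- plus a combination of A 1, …, A n.
    Λ-injective : ∀ A → A 0 ≈ 0# → (∀ p → Λ p A ≈ 0#) → ∀ n → A n ≈ 0#
    Λ-injective A A0 ΛA n = below n n ℕₚ.≤-refl
      where
      below : ∀ n j → j ≤ n → A j ≈ 0#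
      below zero .zero z≤n = A0
      below (suc n) j j≤1+n with j ℕₚ.≟ suc n
      ... | no j≢1+n = below n j (ℕₚ.≤-pred (ℕₚ.≤∧≢⇒< j≤1+n j≢1+n))
      ... | yes ≡.refl = begin
        A (suc n)                                           ≈⟨ *-identityʳ _ ⟨
        A (suc n) * 1#                                      ≈⟨ *-congˡ W-at-0 ⟨
        A (suc n) * W (n ∸ n)                               ≈⟨ *-identityˡ _ ⟨
        1# * (A (suc n) * W (n ∸ n))                        ≈⟨ *-congʳ (trans (ι-cong (nCn≡1 n)) ι-1) ⟨
        ι (n C n) * (A (suc n) * W (n ∸ n))                 ≈⟨ Σ-single n n ℕₚ.≤-refl lower-terms ⟨
        Λ n A                                               ≈⟨ ΛA n ⟩
        0#                                                  ∎
        where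
        W : Moments
        W = dot -[1+ n ] lam
        W-at-0 : W (n ∸ n) ≈ 1#
        W-at-0 = trans (reflexive (≡.cong W (ℕₚ.n∸n≡0 n))) (dot-at-0 -[1+ n ] lam)
        lower-terms : ∀ i → i ≤ n → i ≢ n → ι (n C i) * (A (suc i) * W (n ∸ i)) ≈ 0#
        lower-terms i i≤n i≢n = trans (*-congˡ (trans (*-congʳ (below n (suc i) (ℕₚ.≤∧≢⇒< i≤n i≢n))) (zeroˡ _))) (zeroʳ _)

    lagrange : ∀ α → α 0 ≈ 1# → comp (𝔎 α lam) ≋ α
    lagrange α α0 n = sym (difference-zero (Λ-injective (α ⊟ comp K) A0 ΛA n))
      where
      K : Moments
      K = 𝔎 α lam
      A0 : α 0 - comp K 0 ≈ 0#
      A0 = trans (+-cong α0 (-‿cong (trans (*-identityˡ _) (U-zero 0)))) (-‿inverseʳ 1#)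
      -- K (p+1) is by definition Λ p α
      ΛA : ∀ p → Λ p (α ⊟ comp K) ≈ 0#
      ΛA p = trans (⊕-subʳ (D α) (D (comp K)) (dot -[1+ p ] lam) p) (trans (+-congˡ (-‿cong (Λ-comp K p))) (-‿inverseʳ _))
      difference-zero : ∀ {x y} → x - y ≈ 0# → x ≈ y
      difference-zero {x} {y} x-y≈0 = begin
        x                ≈⟨ +-identityʳ x ⟨
        x + 0#           ≈⟨ +-congˡ (-‿inverseˡ y) ⟨
        x + (- y + y)    ≈⟨ +-assoc _ _ _ ⟨
        (x - y) + y      ≈⟨ +-congʳ x-y≈0 ⟩
        0# + y           ≈⟨ +-identityˡ y ⟩
        y                ∎

    ⊕-comp : ∀ Q K N → (Q ⊕ comp K) N ≈ Σ≤ N (λ i → ι (N C i) * (K i * (Q ⊕ dot (+ i) lam) (N ∸ i)))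
    ⊕-comp Q K N = begin
      (Q ⊕ comp K) N
        ≈⟨ ⊕-congᵇʳ Q N (λ n n≤N → comp-truncate N K n n≤N) ⟩
      (Q ⊕ SumM N (λ i → K i · U i)) N
        ≈⟨ ⊕-SumMʳ N Q (λ i → K i · U i) N ⟩
      Σ≤ N (λ i → (Q ⊕ (K i · U i)) N)
        ≈⟨ Σ-cong N (λ i i≤N → trans (⊕-scaleʳ (K i) Q (U i) N) (*-congˡ (Q⊕U i i≤N))) ⟩
      Σ≤ N (λ i → K i * (ι (N C i) * (Q ⊕ dot (+ i) lam) (N ∸ i)))
        ≈⟨ Σ-cong N (λ i _ → x∙yz≈y∙xz _ _ _) ⟩
      Σ≤ N (λ i → ι (N C i) * (K i * (Q ⊕ dot (+ i) lam) (N ∸ i))) ∎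
      where
      Q⊕U : ∀ i → i ≤ N → (Q ⊕ U i) N ≈ ι (N C i) * (Q ⊕ dot (+ i) lam) (N ∸ i)
      Q⊕U i i≤N = begin
        (Q ⊕ U i) N                                    ≈⟨ ⊕-lcomm Q (T i) (dot (+ i) lam) N ⟩
        (T i ⊕ (Q ⊕ dot (+ i) lam)) N
          ≈⟨ reflexive (≡.cong (T i ⊕ (Q ⊕ dot (+ i) lam)) (≡.sym (ℕₚ.m+[n∸m]≡n i≤N))) ⟩
        (T i ⊕ (Q ⊕ dot (+ i) lam)) (i +ℕ (N ∸ i))     ≈⟨ T-eval i (N ∸ i) (Q ⊕ dot (+ i) lam) ⟩
        ι (B i (N ∸ i)) * (Q ⊕ dot (+ i) lam) (N ∸ i)  ≈⟨ *-congʳ (ι-cong (≡.sym (C≡B i≤N))) ⟩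
        ι (N C i) * (Q ⊕ dot (+ i) lam) (N ∸ i)        ∎

    -- The umbral identity γ + k.α ≡ γ + (k-m).α + m.α with
    -- m.α ≡ m.(comp 𝔎_{α,λ}) ≡ comp (m.𝔎_{α,λ}), expanded by ⊕-comp.
    expansion : ∀ α → α 0 ≈ 1# → ∀ γ k m N →
      (γ ⊕ dot (+ k) α) N
        ≈ Σ≤ N (λ i → ι (N C i) * (dot m (𝔎 α lam) i * (γ ⊕ dot (+ k -ℤ m) α ⊕ dot (+ i) lam) (N ∸ i)))
    expansion α α0 γ k m N = begin
      (γ ⊕ dot (+ k) α) N                       ≈⟨ ⊕-cong (≋-refl {γ}) split-k N ⟩
      (γ ⊕ (dot (+ k -ℤ m) α ⊕ dot m α)) N      ≈⟨ ⊕-assoc γ (dot (+ k -ℤ m) α) (dot m α) N ⟨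
      (Q ⊕ dot m α) N                           ≈⟨ ⊕-cong (≋-refl {Q}) (≋-sym dot-m-α) N ⟩
      (Q ⊕ comp (dot m (𝔎 α lam))) N            ≈⟨ ⊕-comp Q (dot m (𝔎 α lam)) N ⟩
      Σ≤ N (λ i → ι (N C i) * (dot m (𝔎 α lam) i * (Q ⊕ dot (+ i) lam) (N ∸ i))) ∎
      where
      Q : Moments
      Q = γ ⊕ dot (+ k -ℤ m) α
      k-m+m : + k -ℤ m ℤ.+ m ≡ + k
      k-m+m = ≡.trans (ℤₚ.+-assoc (+ k) (ℤ.- m) m)
                (≡.trans (≡.cong (λ t → + k ℤ.+ t) (ℤₚ.+-inverseˡ m)) (ℤₚ.+-identityʳ (+ k)))
      split-k : dot (+ k) α ≋ dot (+ k -ℤ m) α ⊕ dot m α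
      split-k = ≋-trans (dot-congˡ α (≡.sym k-m+m)) (≋-sym (dot-+ α α0 (+ k -ℤ m) m))
      dot-m-α : comp (dot m (𝔎 α lam)) ≋ dot m α
      dot-m-α = ≋-trans (comp-dot m (𝔎 α lam)) (dot-cong m (lagrange α α0))

module Factorials {a ℓ} (R : CommutativeRing a ℓ) where
  open CommutativeRing R hiding (zero)
  open UC R
  open Sums R
  open Binomial using (C-factorials)
  open import Relation.Binary.Reasoning.Setoid setoid
  open import Algebra.Properties.CommutativeSemigroup *-commutativeSemigroup using (interchange)
  open import Algebra.Solver.CommutativeMonoid *-commutativeMonoid using (solve; _⊜_)
  open import Algebra.Solver.Monoid.Expression using () renaming (_⊕_ to _⊛_)

  module Inverses (invN : ℕ → Carrier) (invN-inverse : ∀ j → ι (suc j) * invN j ≈ 1#) where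

    F : ℕ → Carrier
    F = invfact invN

    factorial-inverse : ∀ n → ι (n !) * F n ≈ 1#
    factorial-inverse zero    = trans (*-identityʳ _) ι-1
    factorial-inverse (suc n) = begin
      ι (suc n *ℕ n !) * (F n * invN n)          ≈⟨ *-congʳ (ι-* (suc n) (n !)) ⟩
      (ι (suc n) * ι (n !)) * (F n * invN n)     ≈⟨ *-congʳ (*-comm _ _) ⟩
      (ι (n !) * ι (suc n)) * (F n * invN n)     ≈⟨ interchange _ _ _ _ ⟩
      (ι (n !) * F n) * (ι (suc n) * invN n)     ≈⟨ *-cong (factorial-inverse n) (invN-inverse n) ⟩
      1# * 1#                                    ≈⟨ *-identityˡ _ ⟩
      1#                                         ∎

    binomial-inverse : ∀ N i → i ≤ N → ι (N C i) * F N ≈ F i * F (N ∸ i)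
    binomial-inverse N i i≤N = begin
      ι (N C i) * F N
        ≈⟨ *-identityʳ _ ⟨
      ι (N C i) * F N * 1#
        ≈⟨ *-congˡ (trans (*-cong (factorial-inverse i) (factorial-inverse b)) (*-identityˡ 1#)) ⟨
      ι (N C i) * F N * ((ι (i !) * F i) * (ι (b !) * F b))
        ≈⟨ solve 6 (λ x f p g q h → ((x ⊛ f) ⊛ ((p ⊛ g) ⊛ (q ⊛ h))) ⊜ (((x ⊛ (p ⊛ q)) ⊛ f) ⊛ (g ⊛ h))) refl
                   (ι (N C i)) (F N) (ι (i !)) (F i) (ι (b !)) (F b) ⟩
      ((ι (N C i) * (ι (i !) * ι (b !))) * F N) * (F i * F b)
        ≈⟨ *-congʳ (*-congʳ factorials) ⟩
      (ι (N !) * F N) * (F i * F b)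
        ≈⟨ trans (*-congʳ (factorial-inverse N)) (*-identityˡ _) ⟩
      F i * F b ∎
      where
      b : ℕ
      b = N ∸ i
      factorials : ι (N C i) * (ι (i !) * ι (b !)) ≈ ι (N !)
      factorials = begin
        ι (N C i) * (ι (i !) * ι (b !))   ≈⟨ *-congˡ (ι-* (i !) (b !)) ⟨
        ι (N C i) * ι (i ! *ℕ b !)        ≈⟨ ι-* (N C i) (i ! *ℕ b !) ⟨
        ι ((N C i) *ℕ (i ! *ℕ b !))       ≈⟨ ι-cong (C-factorials i≤N) ⟩
        ι (N !)                           ∎

module Riordan {a ℓ} (R : CommutativeRing a ℓ) where
  open CommutativeRing R hiding (zero)
  open UC R
  open Sums R
  open Composition R
  open Factorials R
  open import Relation.Binary.Reasoning.Setoid setoid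
  open import Algebra.Solver.CommutativeMonoid *-commutativeMonoid using (solve; _⊜_)
  open import Algebra.Solver.Monoid.Expression using () renaming (_⊕_ to _⊛_)

  module _ (invN : ℕ → Carrier) (invN-inverse : ∀ j → ι (suc j) * invN j ≈ 1#) where
    open Inverses invN invN-inverse

    -- First form: the expansion with the binomial coefficient split into
    -- the factorials 1/i! and 1/(N-i)!.
    riordan-expansion : (c cinv : ℕ → Carrier) (γ α lam : Moments) → α 0 ≈ 1# → lam 0 ≈ 1# →
      ∀ m n k →
      ωRiordan invN c cinv γ α n k
        ≈ c n * cinv k
          * Σ≤ (n ∸ k) (λ i →
              (dot m (𝔎 α lam) i * F i)
              * ((γ ⊕ dot (+ k -ℤ m) α ⊕ dot (+ i) lam) (n ∸ k ∸ i) * F (n ∸ k ∸ i)))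
    riordan-expansion c cinv γ α lam α0 lam0 m n k = *-congˡ (begin
      (γ ⊕ dot (+ k) α) N * F N
        ≈⟨ *-congʳ (expansion lam lam0 α α0 γ k m N) ⟩
      Σ≤ N (λ i → ι (N C i) * (K i * X i (N ∸ i))) * F N
        ≈⟨ Σ-*ʳ N (F N) _ ⟩
      Σ≤ N (λ i → ι (N C i) * (K i * X i (N ∸ i)) * F N)
        ≈⟨ Σ-cong N (λ i i≤N → split-factorials i i≤N) ⟩
      Σ≤ N (λ i → (K i * F i) * (X i (N ∸ i) * F (N ∸ i))) ∎)
      where
      N : ℕ
      N = n ∸ k
      K : Moments
      K = dot m (𝔎 α lam)
      X : ℕ → Moments
      X i = γ ⊕ dot (+ k -ℤ m) α ⊕ dot (+ i) lam
      split-factorials : ∀ i → i ≤ N → ι (N C i) * (K i * X i (N ∸ i)) * F N ≈ (K i * F i) * (X i (N ∸ i) * F (N ∸ i))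
      split-factorials i i≤N = begin
        ι (N C i) * (K i * X i (N ∸ i)) * F N
          ≈⟨ solve 4 (λ b x y f → ((b ⊛ (x ⊛ y)) ⊛ f) ⊜ ((x ⊛ y) ⊛ (b ⊛ f))) refl (ι (N C i)) (K i) (X i (N ∸ i)) (F N) ⟩
        (K i * X i (N ∸ i)) * (ι (N C i) * F N)
          ≈⟨ *-congˡ (binomial-inverse N i i≤N) ⟩
        (K i * X i (N ∸ i)) * (F i * F (N ∸ i))
          ≈⟨ solve 4 (λ x y f g → ((x ⊛ y) ⊛ (f ⊛ g)) ⊜ ((x ⊛ f) ⊛ (y ⊛ g))) refl (K i) (X i (N ∸ i)) (F i) (F (N ∸ i)) ⟩
        (K i * F i) * (X i (N ∸ i) * F (N ∸ i)) ∎

  -- Second form: the weights c_N/c_i of the ω-Riordan entries cancel against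
  -- the factors c_i and 1/c_N.
  recombine : (c cinv : ℕ → Carrier) → (∀ j → c j * cinv j ≈ 1#) →
              ∀ N (y z : ℕ → Carrier) →
              cinv N * Σ≤ N (λ i → c i * y i * (c N * cinv i * z i)) ≈ Σ≤ N (λ i → y i * z i)
  recombine c cinv c-inverse N y z = begin
    cinv N * Σ≤ N (λ i → c i * y i * (c N * cinv i * z i))
      ≈⟨ *-congˡ (Σ-cong N (λ i _ → trans (regroup (c i) (y i) (c N) (cinv i) (z i))
                                          (trans (*-congʳ (c-inverse i)) (*-identityˡ _)))) ⟩
    cinv N * Σ≤ N (λ i → c N * (y i * z i))
      ≈⟨ *-congˡ (Σ-*ˡ N (c N) _) ⟨
    cinv N * (c N * Σ≤ N (λ i → y i * z i))
      ≈⟨ *-assoc _ _ _ ⟨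
    (cinv N * c N) * Σ≤ N (λ i → y i * z i)
      ≈⟨ trans (*-congʳ (trans (*-comm _ _) (c-inverse N))) (*-identityˡ _) ⟩
    Σ≤ N (λ i → y i * z i) ∎
    where
    regroup : ∀ ci yi cN cinvi zi → ci * yi * (cN * cinvi * zi) ≈ (ci * cinvi) * (cN * (yi * zi))
    regroup = solve 5 (λ ci yi cN cinvi zi → ((ci ⊛ yi) ⊛ ((cN ⊛ cinvi) ⊛ zi)) ⊜ ((ci ⊛ cinvi) ⊛ (cN ⊛ (yi ⊛ zi)))) refl

-- Theorem 3.11.  The proof does not need γ 0 = 1, c 0 = 1 or the moments of
-- ω (which only motivate the arrays), nor k ≤ n: both sides depend on n ∸ k.
theorem3p11 : ∀ {a ℓ} (R : CommutativeRing a ℓ) →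
    let open CommutativeRing R
        open UC R
    in (invN : ℕ → Carrier) → (∀ j → ι (suc j) * invN j ≈ 1#) →
       (c cinv : ℕ → Carrier) → (∀ j → c j * cinv j ≈ 1#) → c 0 ≈ 1# →
       (ω : Moments) → (∀ j → ω j * c j ≈ ι (j !)) →
       (γ α lam : Moments) → γ 0 ≈ 1# → α 0 ≈ 1# → lam 0 ≈ 1# →
       (m : ℤ) (n k : ℕ) → k ≤ n →
       (ωRiordan invN c cinv γ α n k
          ≈ c n * cinv k
            * Σ≤ (n ∸ k) (λ i →
                (dot m (𝔎 α lam) i * invfact invN i)
                * ((γ ⊕ dot (+ k -ℤ m) α ⊕ dot (+ i) lam) (n ∸ k ∸ i)
                   * invfact invN (n ∸ k ∸ i))))
       × (ωRiordan invN c cinv γ α n k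
          ≈ c n * cinv k * cinv (n ∸ k)
            * Σ≤ (n ∸ k) (λ i →
                c i * (dot m (𝔎 α lam) i * invfact invN i)
                * ωRiordan invN c cinv (γ ⊕ dot (+ k -ℤ m) α) lam (n ∸ k) i))
theorem3p11 R invN invN-inverse c cinv c-inverse _ _ _ γ α lam _ α0 lam0 m n k _ =
  first , trans first (sym second)
  where
  open CommutativeRing R
  open UC R
  open Riordan R
  N : ℕ
  N = n ∸ k
  y z : ℕ → Carrier
  y i = dot m (𝔎 α lam) i * invfact invN i
  z i = (γ ⊕ dot (+ k -ℤ m) α ⊕ dot (+ i) lam) (N ∸ i) * invfact invN (N ∸ i)
  first : ωRiordan invN c cinv γ α n k ≈ c n * cinv k * Σ≤ N (λ i → y i * z i)
  first = riordan-expansion invN invN-inverse c cinv γ α lam α0 lam0 m n k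
  second : c n * cinv k * cinv N * Σ≤ N (λ i → c i * y i * (c N * cinv i * z i)) ≈ c n * cinv k * Σ≤ N (λ i → y i * z i)
  second = trans (*-assoc _ _ _) (*-congˡ (recombine c cinv c-inverse N y z))
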